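{- If $|q|<1$, then \[ \sum_{n = 1}^\infty \left(\sum_{\pi \in \mathcal{D}_2(n)} (-1)^{\# (\pi)-s_2(\pi)}\right) q^n= \sum_{n=2}^{\infty}\frac{(-1)^{n}q^{n(n+1)/2}}{(q;q)_{n-2}(1+q^{n-1})(1+q^{n})}=(q;q)_\infty-(q;q^2)_\infty(q^2;q)_\infty. \]
   Context: $\mathcal{D}_2(n)$ denotes the set of partitions of $n$ into distinct parts having at least two parts; for such $\pi$, $\#(\pi)$ is the number of parts and $s_2(\pi)$ is the second smallest part. Here $(a;q)_n=(1-a)\cdots(1-aq^{n-1})$, $(a;q)_0=1$, and $(a;p)_\infty=\prod_{j\ge0}(1-ap^j)$. -}

module Defs where

open import Data.Bool using (Bool; true; false; if_then_else_; _∧_)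
open import Data.Nat as ℕ using (ℕ; zero; suc; _∸_; _≡ᵇ_; _≤ᵇ_)
open import Data.Integer using (ℤ; +_; -_; _+_; _*_; _-_; ∣_∣)
open import Data.Nat.ListAction using (sum)
open import Data.List using (List; []; _∷_; length; map; upTo; _++_; filterᵇ; foldr)

sublists : {A : Set} → List A → List (List A)
sublists [] = [] ∷ []
sublists (x ∷ xs) = map (x ∷_) (sublists xs) ++ sublists xs

oneTo : ℕ → List ℕ
oneTo n = map suc (upTo n)

-- A partition of n into distinct parts = a subset of {1,…,n} with sum n;
-- it is listed with parts in increasing order.
-- 𝒟₂(n): those having at least two parts.
D₂ : ℕ → List (List ℕ)
D₂ n = filterᵇ (λ π → (sum π ≡ᵇ n) ∧ (2 ≤ᵇ length π)) (sublists (oneTo n))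

numParts : List ℕ → ℕ
numParts = length

-- second smallest part s₂(π) (parts listed increasingly; only used when ≥ 2 parts)
s₂ : List ℕ → ℕ
s₂ (x ∷ y ∷ _) = y
s₂ _ = 0

evenᵇ : ℕ → Bool
evenᵇ zero = true
evenᵇ (suc n) = if evenᵇ n then false else true

neg1^ : ℤ → ℤ
neg1^ z = if evenᵇ ∣ z ∣ then + 1 else - (+ 1)

sumℤ : List ℤ → ℤ
sumℤ = foldr _+_ (+ 0)

a : ℕ → ℤ
a n = sumℤ (map (λ π → neg1^ (+ numParts π - + s₂ π)) (D₂ n))

PS : Set
PS = ℕ → ℤ

Σ< : ℕ → (ℕ → ℤ) → ℤ
Σ< zero f = + 0
Σ< (suc n) f = Σ< n f + f n

_⊛_ : PS → PS → PS
(f ⊛ g) n = Σ< (suc n) (λ i → f i * g (n ∸ i))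
infixl 7 _⊛_

_⊖_ : PS → PS → PS
(f ⊖ g) n = f n - g n

mono : ℤ → ℕ → PS
mono c k n = if k ≡ᵇ n then c else + 0

oneP : PS
oneP = mono (+ 1) 0

oneMinusQ^ : ℕ → PS
oneMinusQ^ k = oneP ⊖ mono (+ 1) k

onePlusQ^ : ℕ → PS
onePlusQ^ k n = oneP n + mono (+ 1) k n

-- (q^s ; q^t)_m = ∏_{j<m} (1 - q^{s + t j})
poch : ℕ → ℕ → ℕ → PS
poch s t zero = oneP
poch s t (suc m) = poch s t m ⊛ oneMinusQ^ (s ℕ.+ t ℕ.* m)

-- (q^s ; q^t)_∞ for s ≥ 1: its q^n coefficient equals that of the finite
-- product over j ≤ n (all further factors are 1 + O(q^{n+1})).
pochInf : ℕ → ℕ → PS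
pochInf s t n = poch s t (suc n) n

-- multiplicative inverse of a power series with constant term 1
-- invList f n = [c_n, c_{n-1}, …, c_0], c = 1/f
nth : List ℤ → ℕ → ℤ
nth [] _ = + 0
nth (x ∷ xs) zero = x
nth (x ∷ xs) (suc k) = nth xs k

invList : PS → ℕ → List ℤ
invList f zero = + 1 ∷ []
invList f (suc n) =
  let cs = invList f n in
  (- Σ< (suc n) (λ k → f (suc k) * nth cs k)) ∷ cs

invPS : PS → PS
invPS f n = nth (invList f n) 0

lhsPS : PS
lhsPS zero = + 0
lhsPS (suc n) = a (suc n)

term : ℕ → PS
term n = mono (neg1^ (+ n)) ((n ℕ.* suc n) ℕ./ 2)
         ⊛ invPS (poch 1 1 (n ∸ 2))
         ⊛ invPS (onePlusQ^ (n ∸ 1))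
         ⊛ invPS (onePlusQ^ n)

-- Σ_{n ≥ 2} term n; the q^m coefficient only receives contributions from
-- n ≤ m+1 since term n = O(q^{n(n+1)/2}).
midPS : PS
midPS m = Σ< m (λ k → term (2 ℕ.+ k) m)

rhsPS : PS
rhsPS = pochInf 1 1 ⊖ (pochInf 1 2 ⊛ pochInf 2 1)

-- The three series are compared through generating functions of subsets π of a range of integers,
-- weighted by (−1)^(#π − sₖ(π)) for k = 0, 1, 2 (with s₀ = 0). Splitting off the smallest part gives
-- gf₀(x ∷ R) = (1 − q^x) gf₀(R), gf₁(x ∷ R) = gf₁(R) − (−1)^x q^x gf₀(R), gf₂(x ∷ R) = gf₂(R) − q^x gf₁(R),
-- and the left-hand series is read off gf₂ on {1, …, n}.
--
-- Middle: the sums over n of (−1)ⁿ q^(C(n,2) + kn) / (q;q)ₙ and of two analogues carrying the extra factors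
-- 1/(1 + q^(n+1)) and 1/(1 + q^(n+2)) satisfy the same recursions in k, termwise, and agree with gfₖ on the
-- empty range below q^k; hence gf₂ on {1, …, n} agrees with the k = 1 member below q^(n+1).
--
-- Right: gf₁ = −S₁, where S_j(R) sums (−1)^x q^(jx) gf₀(R after x) over x ∈ R. With A = (q;q)_N, summation by
-- parts gives A + S_(j+1) ≡ (1 + q^j)(A + S_j) modulo q^(N+1) for j ≥ 1, and A + S_(N+1) ≡ A, so A + S₁ ≡ (q;q²)_N A by
-- Euler's (−q;q)_N (q;q²)_N ≡ 1, itself from (−q;q)_M (q;q)_M = (q²;q²)_M and (q;q²)_M (q²;q²)_M = (q;q)_2M.
-- Finally (1 − q) gf₂ = q S₁ − S₂ gives gf₂ ≡ (q;q)_N − (q;q²)_N (q²;q)_(N−1).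

module Submission where

open import Algebra.Bundles using (CommutativeRing)
open import Algebra.Solver.Ring.AlmostCommutativeRing
  using (AlmostCommutativeRing; fromCommutativeRing; _-Raw-AlmostCommutative⟶_)
open import Algebra.Structures using (IsCommutativeRing)
open import Data.Bool using (true; false; if_then_else_; _∧_)
open import Data.Integer as ℤ using (ℤ; +_; -_; _+_; _*_; _-_; -[1+_]; ∣_∣)
import Data.Integer.Properties as ℤₚ
open import Data.Integer.Tactic.RingSolver using (solve-∀)
open import Data.List using (List; []; _∷_; length; map; _++_; filterᵇ; applyUpTo)
open import Data.List.Properties using (map-++; map-cong; map-∘)
open import Data.Maybe using (Maybe; just; nothing)
open import Data.Nat as ℕ using (ℕ; zero; suc; _∸_; _≡ᵇ_; _≤ᵇ_; s≤s)
open import Data.Nat.DivMod using (m*n/n≡m)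
open import Data.Nat.ListAction using (sum)
import Data.Nat.Properties as ℕₚ
open import Data.Nat.Tactic.RingSolver using () renaming (solve-∀ to ℕ-solve-∀)
open import Data.Product using (_×_; _,_; proj₂; ∃)
open import Data.Sum using (_⊎_; inj₁; inj₂)
open import Function using (id)
open import Relation.Binary.Bundles using (Setoid)
open import Relation.Binary.PropositionalEquality
  using (_≡_; _≢_; refl; sym; trans; cong; cong₂; subst; _≗_; module ≡-Reasoning)
import Relation.Binary.Reasoning.Setoid as SetoidReasoning
open import Relation.Nullary using (yes; no)
open import Relation.Nullary.Decidable using (dec-true; dec-false)

open import Defs

Σ<-cong : ∀ n {F G : ℕ → ℤ} → (∀ i → i ℕ.< n → F i ≡ G i) → Σ< n F ≡ Σ< n G
Σ<-cong zero    eq = refl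
Σ<-cong (suc n) eq = cong₂ _+_ (Σ<-cong n (λ i i<n → eq i (ℕₚ.m<n⇒m<1+n i<n))) (eq n ℕₚ.≤-refl)

Σ<-cong′ : ∀ n {F G : ℕ → ℤ} → (∀ i → F i ≡ G i) → Σ< n F ≡ Σ< n G
Σ<-cong′ n eq = Σ<-cong n (λ i _ → eq i)

Σ<-suc-head : ∀ n (F : ℕ → ℤ) → Σ< (suc n) F ≡ F 0 + Σ< n (λ i → F (suc i))
Σ<-suc-head zero    F = ℤₚ.+-comm (+ 0) (F 0)
Σ<-suc-head (suc n) F = begin
  Σ< (suc n) F + F (suc n)                    ≡⟨ cong (_+ F (suc n)) (Σ<-suc-head n F) ⟩
  (F 0 + Σ< n (λ i → F (suc i))) + F (suc n) ≡⟨ ℤₚ.+-assoc (F 0) _ _ ⟩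
  F 0 + Σ< (suc n) (λ i → F (suc i))         ∎
  where open ≡-Reasoning

Σ<-+ : ∀ n (F G : ℕ → ℤ) → Σ< n (λ i → F i + G i) ≡ Σ< n F + Σ< n G
Σ<-+ zero    F G = refl
Σ<-+ (suc n) F G rewrite Σ<-+ n F G = interchange (Σ< n F) (Σ< n G) (F n) (G n)
  where
  interchange : ∀ a b c d → (a + b) + (c + d) ≡ (a + c) + (b + d)
  interchange = solve-∀

Σ<-*ˡ : ∀ n c (F : ℕ → ℤ) → Σ< n (λ i → c * F i) ≡ c * Σ< n F
Σ<-*ˡ zero    c F = sym (ℤₚ.*-zeroʳ c)
Σ<-*ˡ (suc n) c F rewrite Σ<-*ˡ n c F = sym (ℤₚ.*-distribˡ-+ c (Σ< n F) (F n))

Σ<-zero : ∀ n {F : ℕ → ℤ} → (∀ i → i ℕ.< n → F i ≡ + 0) → Σ< n F ≡ + 0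
Σ<-zero zero    F≡0 = refl
Σ<-zero (suc n) F≡0
  rewrite Σ<-zero n (λ i i<n → F≡0 i (ℕₚ.m<n⇒m<1+n i<n)) | F≡0 n ℕₚ.≤-refl = refl

Σ<-reverse : ∀ n (F : ℕ → ℤ) → Σ< n F ≡ Σ< n (λ i → F (n ∸ suc i))
Σ<-reverse zero    F = refl
Σ<-reverse (suc n) F = begin
  Σ< n F + F n                        ≡⟨ cong (_+ F n) (Σ<-reverse n F) ⟩
  Σ< n (λ i → F (n ∸ suc i)) + F n   ≡⟨ ℤₚ.+-comm _ (F n) ⟩
  F n + Σ< n (λ i → F (n ∸ suc i))   ≡⟨ Σ<-suc-head n (λ i → F (n ∸ i)) ⟨
  Σ< (suc n) (λ i → F (n ∸ i))       ∎
  where open ≡-Reasoning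

Σ<-extend : ∀ n k (F : ℕ → ℤ) → (∀ i → n ℕ.≤ i → F i ≡ + 0) → Σ< (n ℕ.+ k) F ≡ Σ< n F
Σ<-extend n zero    F F≡0 rewrite ℕₚ.+-identityʳ n = refl
Σ<-extend n (suc k) F F≡0
  rewrite ℕₚ.+-suc n k | Σ<-extend n k F F≡0 | F≡0 (n ℕ.+ k) (ℕₚ.m≤m+n n k) = ℤₚ.+-identityʳ _

≡ᵇ-true : ∀ k → (k ≡ᵇ k) ≡ true
≡ᵇ-true k = dec-true (k ℕ.≟ k) refl

≡ᵇ-false : ∀ {k i} → k ≢ i → (k ≡ᵇ i) ≡ false
≡ᵇ-false {k} {i} = dec-false (k ℕ.≟ i)

+-≡ᵇ-cancelˡ : ∀ i j t → (i ℕ.+ j ≡ᵇ i ℕ.+ t) ≡ (j ≡ᵇ t)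
+-≡ᵇ-cancelˡ zero    j t = refl
+-≡ᵇ-cancelˡ (suc i) j t = +-≡ᵇ-cancelˡ i j t

<-or-+ : ∀ k m → m ℕ.< k ⊎ ∃ λ j → m ≡ k ℕ.+ j
<-or-+ k m with k ℕ.≤? m
... | yes k≤m = inj₂ (m ∸ k , sym (ℕₚ.m+[n∸m]≡n k≤m))
... | no  k≰m = inj₁ (ℕₚ.≰⇒> k≰m)

mono-< : ∀ c {k i} → i ℕ.< k → mono c k i ≡ + 0
mono-< c {k} {i} i<k rewrite ≡ᵇ-false (ℕₚ.>⇒≢ i<k) = refl

mono-> : ∀ c {k i} → k ℕ.< i → mono c k i ≡ + 0
mono-> c {k} {i} k<i rewrite ≡ᵇ-false (ℕₚ.<⇒≢ k<i) = refl

mono-≡ : ∀ c k → mono c k k ≡ c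
mono-≡ c k rewrite ≡ᵇ-true k = refl

mono-zero : ∀ k n → mono (+ 0) k n ≡ + 0
mono-zero k n with k ≡ᵇ n
... | true  = refl
... | false = refl

infixl 6 _⊕_
_⊕_ : PS → PS → PS
(f ⊕ g) n = f n + g n

shift : PS → PS
shift f n = f (suc n)

⊛-cong : ∀ {f f′ g g′} → f ≗ f′ → g ≗ g′ → f ⊛ g ≗ f′ ⊛ g′
⊛-cong f≗f′ g≗g′ n = Σ<-cong′ (suc n) (λ i → cong₂ _*_ (f≗f′ i) (g≗g′ (n ∸ i)))

⊛-suc : ∀ f g n → (f ⊛ g) (suc n) ≡ f 0 * g (suc n) + (shift f ⊛ g) n
⊛-suc f g n = Σ<-suc-head (suc n) (λ i → f i * g (suc n ∸ i))

⊛-comm : ∀ f g → f ⊛ g ≗ g ⊛ f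
⊛-comm f g n = begin
  Σ< (suc n) (λ i → f i * g (n ∸ i))                  ≡⟨ Σ<-reverse (suc n) _ ⟩
  Σ< (suc n) (λ i → f (n ∸ i) * g (n ∸ (n ∸ i)))      ≡⟨ Σ<-cong (suc n) swap ⟩
  Σ< (suc n) (λ i → g i * f (n ∸ i))                  ∎
  where
  open ≡-Reasoning
  swap : ∀ i → i ℕ.< suc n → f (n ∸ i) * g (n ∸ (n ∸ i)) ≡ g i * f (n ∸ i)
  swap i i<1+n rewrite ℕₚ.m∸[m∸n]≡n (ℕₚ.≤-pred i<1+n) = ℤₚ.*-comm (f (n ∸ i)) (g i)

⊛-distribʳ : ∀ f g h → (f ⊕ g) ⊛ h ≗ f ⊛ h ⊕ g ⊛ h
⊛-distribʳ f g h n =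
  trans (Σ<-cong′ (suc n) (λ i → ℤₚ.*-distribʳ-+ (h (n ∸ i)) (f i) (g i))) (Σ<-+ (suc n) _ _)

⊛-*ˡ : ∀ c f h → (λ i → c * f i) ⊛ h ≗ (λ n → c * (f ⊛ h) n)
⊛-*ˡ c f h n = trans (Σ<-cong′ (suc n) (λ i → ℤₚ.*-assoc c (f i) (h (n ∸ i)))) (Σ<-*ˡ (suc n) c _)

⊛-assoc : ∀ f g h → (f ⊛ g) ⊛ h ≗ f ⊛ (g ⊛ h)
⊛-assoc f g h zero = reassoc (f 0) (g 0) (h 0)
  where
  reassoc : ∀ a b c → + 0 + (+ 0 + a * b) * c ≡ + 0 + a * (+ 0 + b * c)
  reassoc = solve-∀
⊛-assoc f g h (suc n) = begin
  ((f ⊛ g) ⊛ h) (suc n)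
    ≡⟨ ⊛-suc (f ⊛ g) h n ⟩
  (f ⊛ g) 0 * h (suc n) + (shift (f ⊛ g) ⊛ h) n
    ≡⟨ cong₂ (λ x y → x * h (suc n) + y) (ℤₚ.+-identityˡ (f 0 * g 0))
             (⊛-cong {g = h} {h} (⊛-suc f g) (λ _ → refl) n) ⟩
  f 0 * g 0 * h (suc n) + (((λ i → f 0 * shift g i) ⊕ shift f ⊛ g) ⊛ h) n
    ≡⟨ cong (λ x → f 0 * g 0 * h (suc n) + x) (⊛-distribʳ (λ i → f 0 * shift g i) (shift f ⊛ g) h n) ⟩
  f 0 * g 0 * h (suc n) + (((λ i → f 0 * shift g i) ⊛ h) n + ((shift f ⊛ g) ⊛ h) n)
    ≡⟨ cong₂ (λ x y → f 0 * g 0 * h (suc n) + (x + y)) (⊛-*ˡ (f 0) (shift g) h n) (⊛-assoc (shift f) g h n) ⟩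
  f 0 * g 0 * h (suc n) + (f 0 * (shift g ⊛ h) n + (shift f ⊛ (g ⊛ h)) n)
    ≡⟨ factor (f 0) (g 0) (h (suc n)) ((shift g ⊛ h) n) ((shift f ⊛ (g ⊛ h)) n) ⟩
  f 0 * (g 0 * h (suc n) + (shift g ⊛ h) n) + (shift f ⊛ (g ⊛ h)) n
    ≡⟨ cong (λ x → f 0 * x + (shift f ⊛ (g ⊛ h)) n) (⊛-suc g h n) ⟨
  f 0 * (g ⊛ h) (suc n) + (shift f ⊛ (g ⊛ h)) n
    ≡⟨ ⊛-suc f (g ⊛ h) n ⟨
  (f ⊛ (g ⊛ h)) (suc n) ∎
  where
  open ≡-Reasoning
  factor : ∀ a b c d e → a * b * c + (a * d + e) ≡ a * (b * c + d) + e
  factor = solve-∀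

mono-⊛-< : ∀ c {k} f {n} → n ℕ.< k → (mono c k ⊛ f) n ≡ + 0
mono-⊛-< c f {n} n<k =
  Σ<-zero (suc n) (λ i i≤n → cong (_* f (n ∸ i)) (mono-< c (ℕₚ.≤-<-trans (ℕₚ.≤-pred i≤n) n<k)))

mono-⊛-+ : ∀ c k f j → (mono c k ⊛ f) (k ℕ.+ j) ≡ c * f j
mono-⊛-+ c k f j = begin
  Σ< (suc k ℕ.+ j) (λ i → mono c k i * f (k ℕ.+ j ∸ i))
    ≡⟨ Σ<-extend (suc k) j _ (λ i k<i → cong (_* f (k ℕ.+ j ∸ i)) (mono-> c k<i)) ⟩
  Σ< k (λ i → mono c k i * f (k ℕ.+ j ∸ i)) + mono c k k * f (k ℕ.+ j ∸ k)
    ≡⟨ cong₂ _+_ (Σ<-zero k (λ i i<k → cong (_* f (k ℕ.+ j ∸ i)) (mono-< c i<k)))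
                 (cong₂ _*_ (mono-≡ c k) (cong f (ℕₚ.m+n∸m≡n k j))) ⟩
  + 0 + c * f j
    ≡⟨ ℤₚ.+-identityˡ (c * f j) ⟩
  c * f j ∎
  where open ≡-Reasoning

oneP-⊛ : ∀ f → oneP ⊛ f ≗ f
oneP-⊛ f n = trans (mono-⊛-+ (+ 1) 0 f n) (ℤₚ.*-identityˡ (f n))

sgn : ℕ → ℤ
sgn n = neg1^ (+ n)

sgn-suc : ∀ n → sgn (suc n) ≡ - sgn n
sgn-suc n with evenᵇ n
... | true  = refl
... | false = refl

neg1^-+1 : ∀ z → neg1^ (z + + 1) ≡ - neg1^ z
neg1^-+1 (+ n) rewrite ℤₚ.pos-+ n 1 | ℕₚ.+-comm n 1 = sgn-suc n
neg1^-+1 -[1+ zero ]  = refl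
neg1^-+1 -[1+ suc n ] = sym (trans (cong -_ (sgn-suc (suc n))) (ℤₚ.neg-involutive (sgn (suc n))))

neg1^-neg : ∀ z → neg1^ (- z) ≡ neg1^ z
neg1^-neg z rewrite ℤₚ.∣-i∣≡∣i∣ z = refl

neg1^-+-pos : ∀ a n → neg1^ (a + + n) ≡ neg1^ a * sgn n
neg1^-+-pos a zero rewrite ℤₚ.+-identityʳ a = sym (ℤₚ.*-identityʳ (neg1^ a))
neg1^-+-pos a (suc n) = begin
  neg1^ (a + + suc n)           ≡⟨ cong neg1^ (reassoc a (+ n)) ⟩
  neg1^ (a + + n + + 1)         ≡⟨ neg1^-+1 (a + + n) ⟩
  - neg1^ (a + + n)             ≡⟨ cong -_ (neg1^-+-pos a n) ⟩
  - (neg1^ a * sgn n)           ≡⟨ ℤₚ.neg-distribʳ-* (neg1^ a) (sgn n) ⟩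
  neg1^ a * - sgn n             ≡⟨ cong (neg1^ a *_) (sgn-suc n) ⟨
  neg1^ a * sgn (suc n)         ∎
  where
  open ≡-Reasoning
  reassoc : ∀ a b → a + (+ 1 + b) ≡ a + b + + 1
  reassoc = solve-∀

neg1^-square : ∀ z → neg1^ z * neg1^ z ≡ + 1
neg1^-square z with evenᵇ ∣ z ∣
... | true  = refl
... | false = refl

neg1^-+ : ∀ a b → neg1^ (a + b) ≡ neg1^ a * neg1^ b
neg1^-+ a (+ n)    = neg1^-+-pos a n
neg1^-+ a -[1+ n ] = begin
  neg1^ (a + b)                            ≡⟨ ℤₚ.*-identityʳ (neg1^ (a + b)) ⟨
  neg1^ (a + b) * + 1                      ≡⟨ cong (neg1^ (a + b) *_) (neg1^-square b) ⟨
  neg1^ (a + b) * (neg1^ b * neg1^ b)      ≡⟨ ℤₚ.*-assoc (neg1^ (a + b)) (neg1^ b) (neg1^ b) ⟨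
  neg1^ (a + b) * sgn (suc n) * neg1^ b    ≡⟨ cong (_* neg1^ b) (neg1^-+-pos (a + b) (suc n)) ⟨
  neg1^ (a + b + + suc n) * neg1^ b        ≡⟨ cong (λ z → neg1^ z * neg1^ b) (cancel a n) ⟩
  neg1^ a * neg1^ b                        ∎
  where
  open ≡-Reasoning
  b = -[1+ n ]
  cancel : ∀ a n → a + -[1+ n ] + + suc n ≡ a
  cancel a n rewrite ℤₚ.+-assoc a -[1+ n ] (+ suc n) | ℤₚ.+-inverseˡ (+ suc n) = ℤₚ.+-identityʳ a

sgn-+ : ∀ m n → sgn (m ℕ.+ n) ≡ sgn m * sgn n
sgn-+ m n = trans (cong neg1^ (ℤₚ.pos-+ m n)) (neg1^-+ (+ m) (+ n))

-- The ring of formal power series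

infix 4 _≈_
record _≈_ (f g : PS) : Set where
  constructor coeffwise
  field coeff : f ≗ g
open _≈_ public

infixl 6 _⊞_
infixl 7 _⊠_
infix  8 ⊟_
infix  9 _·q^_ q^_

-- Opaque, so that the goals produced by the ring solver are compared syntactically instead of by unfolding convolutions.
opaque
  _⊞_ : PS → PS → PS
  _⊞_ = _⊕_

  _⊠_ : PS → PS → PS
  _⊠_ = _⊛_

  ⊟_ : PS → PS
  (⊟ f) n = - f n

  _·q^_ : ℤ → ℕ → PS
  _·q^_ = mono

𝟘 𝟙 : PS
𝟘 = (+ 0) ·q^ 0
𝟙 = (+ 1) ·q^ 0

q^_ : ℕ → PS
q^ e = (+ 1) ·q^ e

opaque
  unfolding _⊞_ _⊠_ ⊟_ _·q^_

  coeff-⊞ : ∀ f g n → (f ⊞ g) n ≡ f n + g n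
  coeff-⊞ f g n = refl

  coeff-⊟ : ∀ f n → (⊟ f) n ≡ - f n
  coeff-⊟ f n = refl

  coeff-⊠ : ∀ f g n → (f ⊠ g) n ≡ (f ⊛ g) n
  coeff-⊠ f g n = refl

  coeff-·q^ : ∀ c e n → (c ·q^ e) n ≡ mono c e n
  coeff-·q^ c e n = refl

  ps-isCommutativeRing : IsCommutativeRing _≈_ _⊞_ _⊠_ ⊟_ 𝟘 𝟙
  ps-isCommutativeRing = record
    { isRing = record
      { +-isAbelianGroup = record
        { isGroup = record
          { isMonoid = record
            { isSemigroup = record
              { isMagma = record
                { isEquivalence = record
                  { refl  = coeffwise (λ _ → refl)
                  ; sym   = λ f≈g → coeffwise (λ n → sym (coeff f≈g n))
                  ; trans = λ f≈g g≈h → coeffwise (λ n → trans (coeff f≈g n) (coeff g≈h n)) }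
                ; ∙-cong = λ f≈f′ g≈g′ → coeffwise (λ n → cong₂ _+_ (coeff f≈f′ n) (coeff g≈g′ n)) }
              ; assoc = λ f g h → coeffwise (λ n → ℤₚ.+-assoc (f n) (g n) (h n)) }
            ; identity = (λ f → coeffwise (λ n → trans (cong (_+ f n) (mono-zero 0 n)) (ℤₚ.+-identityˡ (f n))))
                       , (λ f → coeffwise (λ n → trans (cong (λ x → f n + x) (mono-zero 0 n)) (ℤₚ.+-identityʳ (f n)))) }
          ; inverse = (λ f → coeffwise (λ n → trans (ℤₚ.+-inverseˡ (f n)) (sym (mono-zero 0 n))))
                    , (λ f → coeffwise (λ n → trans (ℤₚ.+-inverseʳ (f n)) (sym (mono-zero 0 n))))
          ; ⁻¹-cong = λ f≈g → coeffwise (λ n → cong -_ (coeff f≈g n)) }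
        ; comm = λ f g → coeffwise (λ n → ℤₚ.+-comm (f n) (g n)) }
      ; *-cong = λ f≈f′ g≈g′ → coeffwise (⊛-cong (coeff f≈f′) (coeff g≈g′))
      ; *-assoc = λ f g h → coeffwise (⊛-assoc f g h)
      ; *-identity = (λ f → coeffwise (oneP-⊛ f))
                   , (λ f → coeffwise (λ n → trans (⊛-comm f oneP n) (oneP-⊛ f n)))
      ; distrib = (λ f g h → coeffwise (λ n → trans (⊛-comm f (g ⊕ h) n)
                     (trans (⊛-distribʳ g h f n) (cong₂ _+_ (⊛-comm g f n) (⊛-comm h f n)))))
                , (λ f g h → coeffwise (⊛-distribʳ g h f)) }
    ; *-comm = λ f g → coeffwise (⊛-comm f g) }

  ·q^-+-homo : ∀ a b → (a + b) ·q^ 0 ≈ a ·q^ 0 ⊞ b ·q^ 0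
  ·q^-+-homo a b = coeffwise λ where
    zero    → refl
    (suc n) → refl

  ·q^-* : ∀ a b i j → a ·q^ i ⊠ b ·q^ j ≈ (a * b) ·q^ (i ℕ.+ j)
  ·q^-* a b i j = coeffwise coeffs
    where
    coeffs : ∀ m → (mono a i ⊛ mono b j) m ≡ mono (a * b) (i ℕ.+ j) m
    coeffs m with <-or-+ i m
    ... | inj₁ m<i = trans (mono-⊛-< a (mono b j) m<i)
                           (sym (mono-< (a * b) (ℕₚ.<-≤-trans m<i (ℕₚ.m≤m+n i j))))
    ... | inj₂ (t , refl) rewrite mono-⊛-+ a i (mono b j) t | +-≡ᵇ-cancelˡ i j t with j ≡ᵇ t
    ...   | true  = refl
    ...   | false = ℤₚ.*-zeroʳ a

  ·q^-neg : ∀ c e → (- c) ·q^ e ≈ ⊟ c ·q^ e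
  ·q^-neg c e = coeffwise λ n → if-neg (e ≡ᵇ n)
    where
    if-neg : ∀ b → (if b then - c else + 0) ≡ - (if b then c else + 0)
    if-neg true  = refl
    if-neg false = refl

ps-commutativeRing : CommutativeRing _ _
ps-commutativeRing = record { isCommutativeRing = ps-isCommutativeRing }

open CommutativeRing ps-commutativeRing public
  using ()
  renaming ( refl to ≈-refl; sym to ≈-sym; trans to ≈-trans
           ; +-cong to ⊞-cong; *-cong to ⊠-cong; -‿cong to ⊟-cong; *-assoc to ⊠-assoc; *-comm to ⊠-comm)

module ≈-Reasoning = SetoidReasoning (CommutativeRing.setoid ps-commutativeRing)

·q^-cong : ∀ {c c′ e e′} → c ≡ c′ → e ≡ e′ → c ·q^ e ≈ c′ ·q^ e′
·q^-cong refl refl = ≈-refl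

·q^-⊠ : ∀ {a b c i j k} → a * b ≡ c → i ℕ.+ j ≡ k → a ·q^ i ⊠ b ·q^ j ≈ c ·q^ k
·q^-⊠ {a} {b} {i = i} {j} ab≡c i+j≡k = ≈-trans (·q^-* a b i j) (·q^-cong ab≡c i+j≡k)

·q^-⊠-q^-flip : ∀ {σ σ′ E E′} e → σ′ ≡ - σ → E ℕ.+ e ≡ E′ → σ ·q^ E ⊠ q^ e ≈ ⊟ σ′ ·q^ E′
·q^-⊠-q^-flip {σ} {σ′} {E′ = E′} e σ′≡-σ eq =
  ≈-trans (·q^-⊠ (trans (ℤₚ.*-identityʳ σ) (trans (sym (ℤₚ.neg-involutive σ)) (cong -_ (sym σ′≡-σ)))) eq) (·q^-neg σ′ E′)

coeff-𝟘 : ∀ n → 𝟘 n ≡ + 0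
coeff-𝟘 n = trans (coeff-·q^ (+ 0) 0 n) (mono-zero 0 n)

⊛≈⊠ : ∀ f g → f ⊛ g ≈ f ⊠ g
⊛≈⊠ f g = coeffwise (λ n → sym (coeff-⊠ f g n))

mono-⊛≈ : ∀ c e f → mono c e ⊛ f ≈ c ·q^ e ⊠ f
mono-⊛≈ c e f = coeffwise λ n → sym (trans (coeff-⊠ (c ·q^ e) f n) (⊛-cong {g = f} {f} (coeff-·q^ c e) (λ _ → refl) n))

⊕≈⊞ : ∀ f g → f ⊕ g ≈ f ⊞ g
⊕≈⊞ f g = coeffwise (λ n → sym (coeff-⊞ f g n))

oneMinusQ^≈ : ∀ e → oneMinusQ^ e ≈ 𝟙 ⊞ ⊟ q^ e
oneMinusQ^≈ e = coeffwise λ n → sym (begin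
  (𝟙 ⊞ ⊟ q^ e) n              ≡⟨ coeff-⊞ 𝟙 (⊟ q^ e) n ⟩
  𝟙 n + (⊟ q^ e) n            ≡⟨ cong₂ _+_ (coeff-·q^ (+ 1) 0 n) (trans (coeff-⊟ (q^ e) n) (cong -_ (coeff-·q^ (+ 1) e n))) ⟩
  oneP n - mono (+ 1) e n     ∎)
  where open ≡-Reasoning

onePlusQ^≈ : ∀ e → onePlusQ^ e ≈ 𝟙 ⊞ q^ e
onePlusQ^≈ e = coeffwise λ n → sym (trans (coeff-⊞ 𝟙 (q^ e) n) (cong₂ _+_ (coeff-·q^ (+ 1) 0 n) (coeff-·q^ (+ 1) e n)))

oneP≈𝟙 : oneP ≈ 𝟙
oneP≈𝟙 = coeffwise (λ n → sym (coeff-·q^ (+ 1) 0 n))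

module Solver where
  ps-almostCommutativeRing : AlmostCommutativeRing _ _
  ps-almostCommutativeRing = fromCommutativeRing ps-commutativeRing

  constant : CommutativeRing.rawRing ℤₚ.+-*-commutativeRing -Raw-AlmostCommutative⟶ ps-almostCommutativeRing
  constant = record
    { ⟦_⟧    = _·q^ 0
    ; +-homo = ·q^-+-homo
    ; *-homo = λ a b → ≈-sym (·q^-* a b 0 0)
    ; -‿homo = λ c → ·q^-neg c 0
    ; 0-homo = ≈-refl
    ; 1-homo = ≈-refl }

  constant≟ : ∀ a b → Maybe (a ·q^ 0 ≈ b ·q^ 0)
  constant≟ a b with a ℤ.≟ b
  ... | yes refl = just ≈-refl
  ... | no  _    = nothing

  open import Algebra.Solver.Ring _ ps-almostCommutativeRing constant constant≟ public
    using (solve; _:=_; _:+_; _:*_; :-_; _:-_; con)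

open Solver using (solve; _:=_; _:+_; _:*_; :-_; _:-_; con)

-- Agreement below a given degree

infix 4 _≈[_]_
record _≈[_]_ (f : PS) (B : ℕ) (g : PS) : Set where
  constructor coeffwise<
  field coeff< : ∀ n → n ℕ.< B → f n ≡ g n
open _≈[_]_ public

module _ {B : ℕ} where

  ≈⇒≈[] : ∀ {f g} → f ≈ g → f ≈[ B ] g
  ≈⇒≈[] f≈g = coeffwise< (λ n _ → coeff f≈g n)

  ≈[]-refl : ∀ {f} → f ≈[ B ] f
  ≈[]-refl = coeffwise< (λ _ _ → refl)

  ≈[]-sym : ∀ {f g} → f ≈[ B ] g → g ≈[ B ] f
  ≈[]-sym f≈g = coeffwise< (λ n n<B → sym (coeff< f≈g n n<B))

  ≈[]-trans : ∀ {f g h} → f ≈[ B ] g → g ≈[ B ] h → f ≈[ B ] h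
  ≈[]-trans f≈g g≈h = coeffwise< (λ n n<B → trans (coeff< f≈g n n<B) (coeff< g≈h n n<B))

  ≈[]-⊞ : ∀ {f f′ g g′} → f ≈[ B ] f′ → g ≈[ B ] g′ → f ⊞ g ≈[ B ] f′ ⊞ g′
  ≈[]-⊞ {f} {f′} {g} {g′} f≈f′ g≈g′ = coeffwise< λ n n<B → begin
    (f ⊞ g) n     ≡⟨ coeff-⊞ f g n ⟩
    f n + g n     ≡⟨ cong₂ _+_ (coeff< f≈f′ n n<B) (coeff< g≈g′ n n<B) ⟩
    f′ n + g′ n   ≡⟨ coeff-⊞ f′ g′ n ⟨
    (f′ ⊞ g′) n   ∎
    where open ≡-Reasoning

  ≈[]-⊠ : ∀ {f f′ g g′} → f ≈[ B ] f′ → g ≈[ B ] g′ → f ⊠ g ≈[ B ] f′ ⊠ g′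
  ≈[]-⊠ {f} {f′} {g} {g′} f≈f′ g≈g′ = coeffwise< λ n n<B → begin
    (f ⊠ g) n     ≡⟨ coeff-⊠ f g n ⟩
    (f ⊛ g) n     ≡⟨ Σ<-cong (suc n) (λ i i≤n → cong₂ _*_
                       (coeff< f≈f′ i (ℕₚ.≤-<-trans (ℕₚ.≤-pred i≤n) n<B))
                       (coeff< g≈g′ (n ∸ i) (ℕₚ.≤-<-trans (ℕₚ.m∸n≤m n i) n<B))) ⟩
    (f′ ⊛ g′) n   ≡⟨ coeff-⊠ f′ g′ n ⟨
    (f′ ⊠ g′) n   ∎
    where open ≡-Reasoning

≈[]-⊟ : ∀ {B f g} → f ≈[ B ] g → ⊟ f ≈[ B ] ⊟ g
≈[]-⊟ {f = f} {g} f≈g = coeffwise< λ n n<B →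
  trans (coeff-⊟ f n) (trans (cong -_ (coeff< f≈g n n<B)) (sym (coeff-⊟ g n)))

≈[]-setoid : ℕ → Setoid _ _
≈[]-setoid B = record
  { Carrier = PS ; _≈_ = _≈[ B ]_
  ; isEquivalence = record { refl = ≈[]-refl ; sym = ≈[]-sym ; trans = ≈[]-trans } }

module ≈[]-Reasoning {B} = SetoidReasoning (≈[]-setoid B)

≈[]-weaken : ∀ {f g B B′} → B′ ℕ.≤ B → f ≈[ B ] g → f ≈[ B′ ] g
≈[]-weaken B′≤B f≈g = coeffwise< (λ n n<B′ → coeff< f≈g n (ℕₚ.<-≤-trans n<B′ B′≤B))

record IsCongruence (_∼_ : PS → PS → Set) : Set where
  field
    ≈⇒∼     : ∀ {f g} → f ≈ g → f ∼ g
    ∼-trans : ∀ {f g h} → f ∼ g → g ∼ h → f ∼ h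
    ∼-⊞     : ∀ {f f′ g g′} → f ∼ f′ → g ∼ g′ → (f ⊞ g) ∼ (f′ ⊞ g′)
    ∼-⊠     : ∀ {f f′ g g′} → f ∼ f′ → g ∼ g′ → (f ⊠ g) ∼ (f′ ⊠ g′)

≈-isCongruence : IsCongruence _≈_
≈-isCongruence = record { ≈⇒∼ = λ p → p ; ∼-trans = ≈-trans ; ∼-⊞ = ⊞-cong ; ∼-⊠ = ⊠-cong }

≈[]-isCongruence : ∀ {B} → IsCongruence (_≈[ B ]_)
≈[]-isCongruence = record { ≈⇒∼ = ≈⇒≈[] ; ∼-trans = ≈[]-trans ; ∼-⊞ = ≈[]-⊞ ; ∼-⊠ = ≈[]-⊠ }

-- To derive X ∼ Y from known relations Lᵢ ∼ Rᵢ, the ring solver rewrites X - Y as Σ cᵢ (Lᵢ - Rᵢ).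
module LinearCombination {_∼_ : PS → PS → Set} (isCongruence : IsCongruence _∼_) where
  open IsCongruence isCongruence

  infixl 5 _⊹_
  infix  6 _⋆_

  _⋆_ : ∀ c {L R} → L ∼ R → (c ⊠ (L ⊞ ⊟ R)) ∼ 𝟘
  _⋆_ c {R = R} L∼R = ∼-trans (∼-⊠ (≈⇒∼ ≈-refl) (∼-⊞ L∼R (≈⇒∼ ≈-refl)))
                              (≈⇒∼ (solve 2 (λ c r → c :* (r :- r) := con (+ 0)) ≈-refl c R))

  _⊹_ : ∀ {D E} → D ∼ 𝟘 → E ∼ 𝟘 → (D ⊞ E) ∼ 𝟘
  D∼0 ⊹ E∼0 = ∼-trans (∼-⊞ D∼0 E∼0) (≈⇒∼ (solve 0 (con (+ 0) :+ con (+ 0) := con (+ 0)) ≈-refl))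

  combination : ∀ {X Y D} → X ⊞ ⊟ Y ≈ D → D ∼ 𝟘 → X ∼ Y
  combination {X} {Y} X-Y≈D D∼0 =
    ∼-trans (≈⇒∼ (solve 2 (λ x y → x := (x :- y) :+ y) ≈-refl X Y))
    (∼-trans (∼-⊞ (∼-trans (≈⇒∼ X-Y≈D) D∼0) (≈⇒∼ ≈-refl))
             (≈⇒∼ (solve 1 (λ y → con (+ 0) :+ y := y) ≈-refl Y)))

open LinearCombination ≈-isCongruence public
open module LinearCombination< {B} = LinearCombination (≈[]-isCongruence {B}) public
  renaming (_⋆_ to _⋆<_; _⊹_ to _⊹<_; combination to combination<)

·q^-≈[]𝟘 : ∀ c e → c ·q^ e ≈[ e ] 𝟘
·q^-≈[]𝟘 c e = coeffwise< λ n n<e → begin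
  (c ·q^ e) n      ≡⟨ coeff-·q^ c e n ⟩
  mono c e n       ≡⟨ mono-< c n<e ⟩
  + 0              ≡⟨ mono-zero 0 n ⟨
  mono (+ 0) 0 n   ≡⟨ coeff-·q^ (+ 0) 0 n ⟨
  𝟘 n              ∎
  where open ≡-Reasoning

·q^-⊠-≈[]𝟘 : ∀ c e f → c ·q^ e ⊠ f ≈[ e ] 𝟘
·q^-⊠-≈[]𝟘 c e f = ≈[]-trans (≈[]-⊠ (·q^-≈[]𝟘 c e) ≈[]-refl) (≈⇒≈[] (solve 1 (λ f → con (+ 0) :* f := con (+ 0)) ≈-refl f))

⊠-≈[]𝟘 : ∀ {e f} g → f ≈[ e ] 𝟘 → f ⊠ g ≈[ e ] 𝟘
⊠-≈[]𝟘 g f≈0 = ≈[]-trans (≈[]-⊠ f≈0 ≈[]-refl) (≈⇒≈[] (solve 1 (λ g → con (+ 0) :* g := con (+ 0)) ≈-refl g))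

one-minus-q^-≈[] : ∀ f e → f ⊠ (𝟙 ⊞ ⊟ q^ e) ≈[ e ] f
one-minus-q^-≈[] f e = combination< (solve 2 (λ f x → f :* (con (+ 1) :- x) :- f := (:- f) :* (x :- con (+ 0))) ≈-refl f (q^ e))
  (⊟ f ⋆< ·q^-≈[]𝟘 (+ 1) e)

one-minus-q^-⊠ : ∀ x f → f ⊞ (- + 1) ·q^ x ⊠ f ≈ (𝟙 ⊞ ⊟ q^ x) ⊠ f
one-minus-q^-⊠ x f = combination (solve 3 (λ f m q → f :+ m :* f :- (con (+ 1) :- q) :* f := f :* (m :- (:- q))) ≈-refl f ((- + 1) ·q^ x) (q^ x))
  (f ⋆ ·q^-neg (+ 1) x)

poch-suc : ∀ s t m → poch s t (suc m) ≈ poch s t m ⊠ (𝟙 ⊞ ⊟ q^ (s ℕ.+ t ℕ.* m))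
poch-suc s t m = ≈-trans (⊛≈⊠ _ _) (⊠-cong ≈-refl (oneMinusQ^≈ (s ℕ.+ t ℕ.* m)))

poch-constant : ∀ s t m → poch (suc s) t m 0 ≡ + 1
poch-constant s t zero    = refl
poch-constant s t (suc m) rewrite poch-constant s t m = refl

poch-stable : ∀ s t m d → poch s t (m ℕ.+ d) ≈[ s ℕ.+ t ℕ.* m ] poch s t m
poch-stable s t m zero    rewrite ℕₚ.+-identityʳ m = ≈[]-refl
poch-stable s t m (suc d) rewrite ℕₚ.+-suc m d =
  ≈[]-trans (≈[]-weaken exponent-mono
              (≈[]-trans (≈⇒≈[] (poch-suc s t (m ℕ.+ d))) (one-minus-q^-≈[] (poch s t (m ℕ.+ d)) _)))
            (poch-stable s t m d)
  where
  exponent-mono : s ℕ.+ t ℕ.* m ℕ.≤ s ℕ.+ t ℕ.* (m ℕ.+ d)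
  exponent-mono = ℕₚ.+-monoʳ-≤ s (ℕₚ.*-monoʳ-≤ t (ℕₚ.m≤m+n m d))

pochInf-≈[] : ∀ s t M → pochInf s (suc t) ≈[ s ℕ.+ suc t ℕ.* M ] poch s (suc t) M
pochInf-≈[] s t M = coeffwise< coeffs
  where
  coeffs : ∀ n → n ℕ.< s ℕ.+ suc t ℕ.* M → poch s (suc t) (suc n) n ≡ poch s (suc t) M n
  coeffs n n<B with ℕₚ.≤-total (suc n) M
  ... | inj₁ 1+n≤M = sym (subst (λ K → poch s (suc t) K n ≡ poch s (suc t) (suc n) n) (ℕₚ.m+[n∸m]≡n 1+n≤M)
          (coeff< (poch-stable s (suc t) (suc n) (M ∸ suc n)) n
             (ℕₚ.<-≤-trans (ℕₚ.n<1+n n) (ℕₚ.≤-trans (ℕₚ.m≤n*m (suc n) (suc t)) (ℕₚ.m≤n+m _ s)))))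
  ... | inj₂ M≤1+n = subst (λ K → poch s (suc t) K n ≡ poch s (suc t) M n) (ℕₚ.m+[n∸m]≡n M≤1+n)
          (coeff< (poch-stable s (suc t) M (suc n ∸ M)) n n<B)

nth-invList : ∀ f n i → i ℕ.≤ n → nth (invList f n) i ≡ invPS f (n ∸ i)
nth-invList f n       zero    _         = refl
nth-invList f (suc n) (suc i) (s≤s i≤n) = nth-invList f n i i≤n

invPS-inverse : ∀ f → f 0 ≡ + 1 → f ⊠ invPS f ≈ 𝟙
invPS-inverse f f0≡1 = ≈-trans (≈-sym (⊛≈⊠ f (invPS f))) (≈-trans (coeffwise coeffs) oneP≈𝟙)
  where
  open ≡-Reasoning
  coeffs : f ⊛ invPS f ≗ oneP
  coeffs zero rewrite f0≡1 = refl
  coeffs (suc n) = begin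
    (f ⊛ invPS f) (suc n)                      ≡⟨ ⊛-suc f (invPS f) n ⟩
    f 0 * - c + (shift f ⊛ invPS f) n          ≡⟨ cong₂ (λ u v → u * - c + v) f0≡1
                                                     (Σ<-cong (suc n) (λ i i≤n → cong (f (suc i) *_) (sym (nth-invList f n i (ℕₚ.≤-pred i≤n))))) ⟩
    + 1 * - c + c                              ≡⟨ cancel c ⟩
    + 0                                        ∎
    where
    c = Σ< (suc n) (λ k → f (suc k) * nth (invList f n) k)
    cancel : ∀ x → + 1 * (- x) + x ≡ + 0
    cancel = solve-∀

cancelˡ-≈[] : ∀ {B} c {f g} → c 0 ≡ + 1 → c ⊠ f ≈[ B ] c ⊠ g → f ≈[ B ] g
cancelˡ-≈[] c {f} {g} c0≡1 cf≈cg = combination<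
  (solve 4 (λ c i f g → f :- g := i :* (c :* f :- c :* g) :+ (:- (f :- g)) :* (c :* i :- con (+ 1))) ≈-refl c (invPS c) f g)
  (invPS c ⋆< cf≈cg ⊹< ⊟ (f ⊞ ⊟ g) ⋆< ≈⇒≈[] (invPS-inverse c c0≡1))

-- Subsets weighted by the parity of #π − sₖ(π)

sumℤ-++ : ∀ xs ys → sumℤ (xs ++ ys) ≡ sumℤ xs + sumℤ ys
sumℤ-++ []       ys = sym (ℤₚ.+-identityˡ (sumℤ ys))
sumℤ-++ (x ∷ xs) ys rewrite sumℤ-++ xs ys = sym (ℤₚ.+-assoc x (sumℤ xs) (sumℤ ys))

sumℤ-map-zero : ∀ {A : Set} (g : A → ℤ) → (∀ x → g x ≡ + 0) → ∀ xs → sumℤ (map g xs) ≡ + 0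
sumℤ-map-zero g g≡0 []       = refl
sumℤ-map-zero g g≡0 (x ∷ xs) rewrite g≡0 x | sumℤ-map-zero g g≡0 xs = refl

sumℤ-map-*ˡ : ∀ {A : Set} c (g : A → ℤ) xs → sumℤ (map (λ x → c * g x) xs) ≡ c * sumℤ (map g xs)
sumℤ-map-*ˡ c g []       = sym (ℤₚ.*-zeroʳ c)
sumℤ-map-*ˡ c g (x ∷ xs) rewrite sumℤ-map-*ˡ c g xs = sym (ℤₚ.*-distribˡ-+ c (g x) _)

sumℤ-filterᵇ : ∀ {A : Set} (g : A → ℤ) p xs → sumℤ (map g (filterᵇ p xs)) ≡ sumℤ (map (λ x → if p x then g x else + 0) xs)
sumℤ-filterᵇ g p []       = refl
sumℤ-filterᵇ g p (x ∷ xs) with p x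
... | true  = cong (λ y → g x + y) (sumℤ-filterᵇ g p xs)
... | false = trans (sumℤ-filterᵇ g p xs) (sym (ℤₚ.+-identityˡ _))

weightAt : (List ℕ → ℤ) → ℕ → List ℕ → ℤ
weightAt w n π = if sum π ≡ᵇ n then w π else + 0

subsetGF : (List ℕ → ℤ) → List ℕ → PS
subsetGF w xs n = sumℤ (map (weightAt w n) (sublists xs))

subsetGF-[] : ∀ w → subsetGF w [] ≈ w [] ·q^ 0
subsetGF-[] w = coeffwise λ n → trans (ℤₚ.+-identityʳ _) (sym (coeff-·q^ (w []) 0 n))

sum-containing : ∀ {w v} c x xs → (∀ π → w (x ∷ π) ≡ c * v π) →
                 ∀ n → sumℤ (map (λ π → weightAt w n (x ∷ π)) (sublists xs)) ≡ (mono c x ⊛ subsetGF v xs) n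
sum-containing {w} {v} c x xs w≡cv n with <-or-+ x n
... | inj₁ n<x = trans (sumℤ-map-zero _ too-large (sublists xs)) (sym (mono-⊛-< c (subsetGF v xs) n<x))
  where
  too-large : ∀ π → weightAt w n (x ∷ π) ≡ + 0
  too-large π rewrite ≡ᵇ-false {x ℕ.+ sum π} {n} (λ eq → ℕₚ.<⇒≱ n<x (subst (x ℕ.≤_) eq (ℕₚ.m≤m+n x (sum π)))) = refl
... | inj₂ (j , refl) = begin
  sumℤ (map (λ π → weightAt w (x ℕ.+ j) (x ∷ π)) (sublists xs))   ≡⟨ cong sumℤ (map-cong scaled (sublists xs)) ⟩
  sumℤ (map (λ π → c * weightAt v j π) (sublists xs))             ≡⟨ sumℤ-map-*ˡ c (weightAt v j) (sublists xs) ⟩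
  c * subsetGF v xs j                                             ≡⟨ mono-⊛-+ c x (subsetGF v xs) j ⟨
  (mono c x ⊛ subsetGF v xs) (x ℕ.+ j)                            ∎
  where
  open ≡-Reasoning
  scaled : ∀ π → weightAt w (x ℕ.+ j) (x ∷ π) ≡ c * weightAt v j π
  scaled π rewrite +-≡ᵇ-cancelˡ x (sum π) j with sum π ≡ᵇ j
  ... | true  = w≡cv π
  ... | false = sym (ℤₚ.*-zeroʳ c)

subsetGF-∷ : ∀ {w v} c x xs → (∀ π → w (x ∷ π) ≡ c * v π) →
             subsetGF w (x ∷ xs) ≈ subsetGF w xs ⊞ c ·q^ x ⊠ subsetGF v xs
subsetGF-∷ {w} {v} c x xs w≡cv =
  ≈-trans (coeffwise coeffs) (≈-trans (⊕≈⊞ _ _) (⊞-cong ≈-refl (mono-⊛≈ c x (subsetGF v xs))))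
  where
  open ≡-Reasoning
  coeffs : ∀ n → subsetGF w (x ∷ xs) n ≡ subsetGF w xs n + (mono c x ⊛ subsetGF v xs) n
  coeffs n = begin
    subsetGF w (x ∷ xs) n
      ≡⟨ cong sumℤ (map-++ (weightAt w n) (map (x ∷_) (sublists xs)) (sublists xs)) ⟩
    sumℤ (map (weightAt w n) (map (x ∷_) (sublists xs)) ++ map (weightAt w n) (sublists xs))
      ≡⟨ sumℤ-++ (map (weightAt w n) (map (x ∷_) (sublists xs))) _ ⟩
    sumℤ (map (weightAt w n) (map (x ∷_) (sublists xs))) + subsetGF w xs n
      ≡⟨ cong (_+ subsetGF w xs n) (trans (cong sumℤ (sym (map-∘ (sublists xs)))) (sum-containing {w} {v} c x xs w≡cv n)) ⟩
    (mono c x ⊛ subsetGF v xs) n + subsetGF w xs n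
      ≡⟨ ℤₚ.+-comm ((mono c x ⊛ subsetGF v xs) n) (subsetGF w xs n) ⟩
    subsetGF w xs n + (mono c x ⊛ subsetGF v xs) n ∎

-- weightₖ π = (−1)^(#π − sₖ(π)), where s₀(π) = 0 and s₁, s₂ are the smallest and second smallest parts;
-- it is 0 when π has fewer than k parts.
weight₀ weight₁ weight₂ : List ℕ → ℤ
weight₀ π = sgn (length π)
weight₁ []      = + 0
weight₁ (y ∷ ρ) = neg1^ (+ length (y ∷ ρ) - + y)
weight₂ (x ∷ y ∷ ρ) = neg1^ (+ length (x ∷ y ∷ ρ) - + y)
weight₂ _           = + 0

gf₀ gf₁ gf₂ : List ℕ → PS
gf₀ = subsetGF weight₀
gf₁ = subsetGF weight₁
gf₂ = subsetGF weight₂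

gf₀-[] : gf₀ [] ≈ 𝟙
gf₀-[] = subsetGF-[] weight₀

gf₁-[] : gf₁ [] ≈ 𝟘
gf₁-[] = subsetGF-[] weight₁

gf₂-[] : gf₂ [] ≈ 𝟘
gf₂-[] = subsetGF-[] weight₂

gf₀-∷ : ∀ x xs → gf₀ (x ∷ xs) ≈ gf₀ xs ⊞ (- + 1) ·q^ x ⊠ gf₀ xs
gf₀-∷ x xs = subsetGF-∷ (- + 1) x xs (λ π → trans (sgn-suc (length π)) (sym (ℤₚ.-1*i≡-i (sgn (length π)))))

gf₁-∷ : ∀ x xs → gf₁ (x ∷ xs) ≈ gf₁ xs ⊞ (- sgn x) ·q^ x ⊠ gf₀ xs
gf₁-∷ x xs = subsetGF-∷ (- sgn x) x xs sign
  where
  sign : ∀ π → neg1^ (+ suc (length π) - + x) ≡ - sgn x * sgn (length π)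
  sign π = begin
    neg1^ (+ suc l + - + x)         ≡⟨ neg1^-+ (+ suc l) (- + x) ⟩
    sgn (suc l) * neg1^ (- + x)     ≡⟨ cong₂ _*_ (sgn-suc l) (neg1^-neg (+ x)) ⟩
    - sgn l * sgn x                 ≡⟨ rearrange (sgn l) (sgn x) ⟩
    - sgn x * sgn l                 ∎
    where
    open ≡-Reasoning
    l = length π
    rearrange : ∀ a b → - a * b ≡ - b * a
    rearrange = solve-∀

gf₂-∷ : ∀ x xs → gf₂ (x ∷ xs) ≈ gf₂ xs ⊞ (- + 1) ·q^ x ⊠ gf₁ xs
gf₂-∷ x xs = subsetGF-∷ (- + 1) x xs sign
  where
  sign : ∀ π → weight₂ (x ∷ π) ≡ - + 1 * weight₁ π
  sign []      = refl
  sign (y ∷ ρ) = begin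
    neg1^ (+ suc (suc l) - + y)          ≡⟨ cong neg1^ (reassoc (+ suc l) (+ y)) ⟩
    neg1^ (+ suc l - + y + + 1)          ≡⟨ neg1^-+1 (+ suc l - + y) ⟩
    - neg1^ (+ suc l - + y)              ≡⟨ ℤₚ.-1*i≡-i _ ⟨
    - + 1 * neg1^ (+ suc l - + y)        ∎
    where
    open ≡-Reasoning
    l = length ρ
    reassoc : ∀ a b → + 1 + a - b ≡ a - b + + 1
    reassoc = solve-∀

a≡gf₂ : ∀ n → a n ≡ gf₂ (oneTo n) n
a≡gf₂ n = trans (sumℤ-filterᵇ _ _ (sublists (oneTo n))) (cong sumℤ (map-cong split-condition (sublists (oneTo n))))
  where
  split-condition : ∀ π → (if (sum π ≡ᵇ n) ∧ (2 ≤ᵇ length π) then neg1^ (+ numParts π - + s₂ π) else + 0)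
                        ≡ (if sum π ≡ᵇ n then weight₂ π else + 0)
  split-condition π with sum π ≡ᵇ n
  split-condition []          | true  = refl
  split-condition (x ∷ [])    | true  = refl
  split-condition (x ∷ y ∷ ρ) | true  = refl
  ... | false = refl

range : ℕ → ℕ → List ℕ
range k zero    = []
range k (suc l) = k ∷ range (suc k) l

oneTo≡range : ∀ n → oneTo n ≡ range 1 n
oneTo≡range n = shifted id 0 n (λ i → refl)
  where
  shifted : ∀ (f : ℕ → ℕ) k n → (∀ i → f i ≡ k ℕ.+ i) → map suc (applyUpTo f n) ≡ range (suc k) n
  shifted f k zero    f≡k+ = refl
  shifted f k (suc n) f≡k+ = cong₂ _∷_ (cong suc (trans (f≡k+ 0) (ℕₚ.+-identityʳ k)))
    (shifted (λ i → f (suc i)) (suc k) n (λ i → trans (f≡k+ (suc i)) (ℕₚ.+-suc k i)))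

gf₀-∷′ : ∀ x xs → gf₀ (x ∷ xs) ≈ (𝟙 ⊞ ⊟ q^ x) ⊠ gf₀ xs
gf₀-∷′ x xs = ≈-trans (gf₀-∷ x xs) (one-minus-q^-⊠ x (gf₀ xs))

poch-∷ : ∀ k l → poch k 1 (suc l) ≈ (𝟙 ⊞ ⊟ q^ k) ⊠ poch (suc k) 1 l
poch-∷ k zero = begin
  poch k 1 1                        ≈⟨ poch-suc k 1 0 ⟩
  oneP ⊠ (𝟙 ⊞ ⊟ q^ (k ℕ.+ 1 ℕ.* 0))  ≈⟨ ⊠-cong oneP≈𝟙 ≈-refl ⟩
  𝟙 ⊠ (𝟙 ⊞ ⊟ q^ (k ℕ.+ 1 ℕ.* 0))   ≈⟨ ⊠-comm 𝟙 _ ⟩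
  (𝟙 ⊞ ⊟ q^ (k ℕ.+ 1 ℕ.* 0)) ⊠ 𝟙   ≈⟨ ⊠-cong (⊞-cong ≈-refl (⊟-cong (·q^-cong refl (ℕₚ.+-identityʳ k)))) ≈-refl ⟩
  (𝟙 ⊞ ⊟ q^ k) ⊠ 𝟙                 ≈⟨ ⊠-cong ≈-refl oneP≈𝟙 ⟨
  (𝟙 ⊞ ⊟ q^ k) ⊠ oneP              ∎
  where open ≈-Reasoning
poch-∷ k (suc l) = begin
  poch k 1 (2 ℕ.+ l)                                                      ≈⟨ poch-suc k 1 (suc l) ⟩
  poch k 1 (suc l) ⊠ (𝟙 ⊞ ⊟ q^ (k ℕ.+ 1 ℕ.* suc l))                        ≈⟨ ⊠-cong (poch-∷ k l) (⊞-cong ≈-refl (⊟-cong (·q^-cong refl (exponent k l)))) ⟩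
  (𝟙 ⊞ ⊟ q^ k) ⊠ poch (suc k) 1 l ⊠ (𝟙 ⊞ ⊟ q^ (suc k ℕ.+ 1 ℕ.* l))        ≈⟨ ⊠-assoc _ _ _ ⟩
  (𝟙 ⊞ ⊟ q^ k) ⊠ (poch (suc k) 1 l ⊠ (𝟙 ⊞ ⊟ q^ (suc k ℕ.+ 1 ℕ.* l)))      ≈⟨ ⊠-cong ≈-refl (poch-suc (suc k) 1 l) ⟨
  (𝟙 ⊞ ⊟ q^ k) ⊠ poch (suc k) 1 (suc l)                                    ∎
  where
  open ≈-Reasoning
  exponent : ∀ k l → k ℕ.+ 1 ℕ.* suc l ≡ suc k ℕ.+ 1 ℕ.* l
  exponent = ℕ-solve-∀

gf₀-range : ∀ k l → gf₀ (range k l) ≈ poch k 1 l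
gf₀-range k zero    = ≈-trans gf₀-[] (≈-sym oneP≈𝟙)
gf₀-range k (suc l) = begin
  gf₀ (k ∷ range (suc k) l)                                  ≈⟨ gf₀-∷′ k (range (suc k) l) ⟩
  (𝟙 ⊞ ⊟ q^ k) ⊠ gf₀ (range (suc k) l)                       ≈⟨ ⊠-cong ≈-refl (gf₀-range (suc k) l) ⟩
  (𝟙 ⊞ ⊟ q^ k) ⊠ poch (suc k) 1 l                            ≈⟨ poch-∷ k l ⟨
  poch k 1 (suc l)                                           ∎
  where open ≈-Reasoning

-- The product side

S : ℕ → List ℕ → PS
S j []       = 𝟘
S j (x ∷ xs) = sgn x ·q^ (j ℕ.* x) ⊠ gf₀ xs ⊞ S j xs

gf₁≈⊟S₁ : ∀ xs → gf₁ xs ≈ ⊟ S 1 xs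
gf₁≈⊟S₁ []       = ≈-trans gf₁-[] (solve 0 (con (+ 0) := :- con (+ 0)) ≈-refl)
gf₁≈⊟S₁ (x ∷ xs) = begin
  gf₁ (x ∷ xs)                                       ≈⟨ gf₁-∷ x xs ⟩
  gf₁ xs ⊞ (- sgn x) ·q^ x ⊠ gf₀ xs                  ≈⟨ ⊞-cong (gf₁≈⊟S₁ xs) (⊠-cong (≈-trans (·q^-neg (sgn x) x) (⊟-cong (·q^-cong refl (sym (ℕₚ.*-identityˡ x))))) ≈-refl) ⟩
  ⊟ S 1 xs ⊞ ⊟ sgn x ·q^ (1 ℕ.* x) ⊠ gf₀ xs          ≈⟨ solve 3 (λ s m g → :- s :+ (:- m) :* g := :- (m :* g :+ s)) ≈-refl (S 1 xs) (sgn x ·q^ (1 ℕ.* x)) (gf₀ xs) ⟩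
  ⊟ S 1 (x ∷ xs)                                     ∎
  where open ≈-Reasoning

gf₂-∷-S : ∀ x xs → gf₂ (x ∷ xs) ≈ gf₂ xs ⊞ q^ x ⊠ S 1 xs
gf₂-∷-S x xs = begin
  gf₂ (x ∷ xs)                          ≈⟨ gf₂-∷ x xs ⟩
  gf₂ xs ⊞ (- + 1) ·q^ x ⊠ gf₁ xs       ≈⟨ ⊞-cong ≈-refl (⊠-cong (·q^-neg (+ 1) x) (gf₁≈⊟S₁ xs)) ⟩
  gf₂ xs ⊞ ⊟ q^ x ⊠ ⊟ S 1 xs            ≈⟨ solve 3 (λ g u s → g :+ (:- u) :* (:- s) := g :+ u :* s) ≈-refl (gf₂ xs) (q^ x) (S 1 xs) ⟩
  gf₂ xs ⊞ q^ x ⊠ S 1 xs                ∎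
  where open ≈-Reasoning

powNegQ : ℕ → ℕ → PS
powNegQ j y = sgn y ·q^ (j ℕ.* y)

powNegQ-suc : ∀ j y → powNegQ j (suc y) ≈ powNegQ j y ⊠ ⊟ q^ j
powNegQ-suc j y = ≈-sym (begin
  powNegQ j y ⊠ ⊟ q^ j               ≈⟨ ⊠-cong ≈-refl (·q^-neg (+ 1) j) ⟨
  powNegQ j y ⊠ (- + 1) ·q^ j        ≈⟨ ·q^-⊠ (trans (ℤₚ.*-comm (sgn y) (- + 1)) (trans (ℤₚ.-1*i≡-i (sgn y)) (sym (sgn-suc y))))
                                              (trans (ℕₚ.+-comm (j ℕ.* y) j) (sym (ℕₚ.*-suc j y))) ⟩
  powNegQ j (suc y)                  ∎)
  where open ≈-Reasoning

powNegQ-⊠-q^ : ∀ j y → powNegQ j y ⊠ q^ y ≈ powNegQ (suc j) y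
powNegQ-⊠-q^ j y = ·q^-⊠ (ℤₚ.*-identityʳ (sgn y)) (ℕₚ.+-comm (j ℕ.* y) y)

-- Summation by parts, using q^x · gf₀(R) = gf₀(R) − gf₀(x ∷ R).
S-suc : ∀ j k l → S (suc j) (range k l) ⊞ powNegQ j k ⊠ gf₀ (range k l)
                ≈ (𝟙 ⊞ q^ j) ⊠ S j (range k l) ⊞ powNegQ j (k ℕ.+ l)
S-suc j k zero = combination
  (solve 4 (λ z z′ a p → con (+ 0) :+ z :* a :- ((con (+ 1) :+ p) :* con (+ 0) :+ z′)
                       := z :* (a :- con (+ 1)) :+ (:- con (+ 1)) :* (z′ :- z))
     ≈-refl (powNegQ j k) (powNegQ j (k ℕ.+ 0)) (gf₀ []) (q^ j))
  (powNegQ j k ⋆ gf₀-[] ⊹ ⊟ 𝟙 ⋆ ·q^-cong (cong sgn (ℕₚ.+-identityʳ k)) (cong (j ℕ.*_) (ℕₚ.+-identityʳ k)))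
S-suc j k (suc l) = combination
  (solve 11 (λ z z₁ m′ t p A Ak S′ Sj E E′ →
       m′ :* A :+ S′ :+ z :* Ak :- ((con (+ 1) :+ p) :* (z :* A :+ Sj) :+ E′)
    := z :* (Ak :- (con (+ 1) :- t) :* A)
    :+ con (+ 1) :* (S′ :+ z₁ :* A :- ((con (+ 1) :+ p) :* Sj :+ E))
    :+ (:- A) :* (z₁ :- z :* (:- p))
    :+ (:- con (+ 1)) :* (E′ :- E)
    :+ (:- A) :* (z :* t :- m′))
    ≈-refl zₖ (powNegQ j (suc k)) (powNegQ (suc j) k) (q^ k) (q^ j)
           (gf₀ R) (gf₀ (k ∷ R)) (S (suc j) R) (S j R) E (powNegQ j (k ℕ.+ suc l)))
  ( zₖ ⋆ gf₀-∷′ k R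
  ⊹ 𝟙 ⋆ S-suc j (suc k) l
  ⊹ ⊟ gf₀ R ⋆ powNegQ-suc j k
  ⊹ ⊟ 𝟙 ⋆ ·q^-cong (cong sgn (ℕₚ.+-suc k l)) (cong (j ℕ.*_) (ℕₚ.+-suc k l))
  ⊹ ⊟ gf₀ R ⋆ powNegQ-⊠-q^ j k)
  where
  R = range (suc k) l
  zₖ = powNegQ j k
  E = powNegQ j (suc k ℕ.+ l)

one-minus-q-⊠-gf₂ : ∀ x l → (𝟙 ⊞ ⊟ q^ 1) ⊠ gf₂ (x ∷ range (suc x) l)
                           ≈ q^ x ⊠ S 1 (range (suc x) l) ⊞ ⊟ S 2 (range (suc x) l)
one-minus-q-⊠-gf₂ x zero = begin
  (𝟙 ⊞ ⊟ q^ 1) ⊠ gf₂ (x ∷ [])            ≈⟨ ⊠-cong ≈-refl (≈-trans (gf₂-∷-S x []) (⊞-cong gf₂-[] ≈-refl)) ⟩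
  (𝟙 ⊞ ⊟ q^ 1) ⊠ (𝟘 ⊞ q^ x ⊠ 𝟘)          ≈⟨ solve 2 (λ v u → (con (+ 1) :- v) :* (con (+ 0) :+ u :* con (+ 0)) := u :* con (+ 0) :- con (+ 0)) ≈-refl (q^ 1) (q^ x) ⟩
  q^ x ⊠ 𝟘 ⊞ ⊟ 𝟘                          ∎
  where open ≈-Reasoning
one-minus-q-⊠-gf₂ x (suc l) = begin
  (𝟙 ⊞ ⊟ q^ 1) ⊠ gf₂ (x ∷ y ∷ R)
    ≈⟨ ⊠-cong ≈-refl (gf₂-∷-S x (y ∷ R)) ⟩
  (𝟙 ⊞ ⊟ q^ 1) ⊠ (gf₂ (y ∷ R) ⊞ q^ x ⊠ S 1 (y ∷ R))
    ≈⟨ solve 3 (λ v g s → (con (+ 1) :- v) :* (g :+ s) := (con (+ 1) :- v) :* g :+ (con (+ 1) :- v) :* s) ≈-refl (q^ 1) (gf₂ (y ∷ R)) (q^ x ⊠ S 1 (y ∷ R)) ⟩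
  (𝟙 ⊞ ⊟ q^ 1) ⊠ gf₂ (y ∷ R) ⊞ (𝟙 ⊞ ⊟ q^ 1) ⊠ (q^ x ⊠ S 1 (y ∷ R))
    ≈⟨ ⊞-cong (one-minus-q-⊠-gf₂ y l) ≈-refl ⟩
  q^ y ⊠ S 1 R ⊞ ⊟ S 2 R ⊞ (𝟙 ⊞ ⊟ q^ 1) ⊠ (q^ x ⊠ S 1 (y ∷ R))
    ≈⟨ combination
         (solve 8 (λ v u uy z₁ z₂ A s₁ s₂′ →
              uy :* s₁ :- s₂′ :+ (con (+ 1) :- v) :* (u :* (z₁ :* A :+ s₁)) :- (u :* (z₁ :* A :+ s₁) :- (z₂ :* A :+ s₂′))
           := s₁ :* (uy :- u :* v) :+ (:- A) :* (z₁ :* uy :- z₂) :+ (A :* z₁) :* (uy :- u :* v))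
           ≈-refl (q^ 1) (q^ x) (q^ y) (powNegQ 1 y) (powNegQ 2 y) (gf₀ R) (S 1 R) (S 2 R))
         (S 1 R ⋆ q^y≈ ⊹ ⊟ gf₀ R ⋆ powNegQ-⊠-q^ 1 y ⊹ gf₀ R ⊠ powNegQ 1 y ⋆ q^y≈) ⟩
  q^ x ⊠ S 1 (y ∷ R) ⊞ ⊟ S 2 (y ∷ R)
    ∎
  where
  open ≈-Reasoning
  y = suc x
  R = range (suc y) l
  q^y≈ : q^ y ≈ q^ x ⊠ q^ 1
  q^y≈ = ≈-sym (·q^-⊠ refl (ℕₚ.+-comm x 1))

S-≈[]𝟘 : ∀ j k l → S j (range (suc k) l) ≈[ j ] 𝟘
S-≈[]𝟘 j k zero    = ≈[]-refl
S-≈[]𝟘 j k (suc l) = ≈[]-trans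
  (≈[]-⊞ (≈[]-weaken (ℕₚ.m≤m*n j (suc k)) (·q^-⊠-≈[]𝟘 _ (j ℕ.* suc k) _)) (S-≈[]𝟘 j (suc k) l))
  (≈⇒≈[] (solve 0 (con (+ 0) :+ con (+ 0) := con (+ 0)) ≈-refl))

plusPoch : ℕ → PS
plusPoch zero    = 𝟙
plusPoch (suc M) = plusPoch M ⊠ (𝟙 ⊞ q^ (suc M))

H : ℕ → ℕ → PS
H N j = gf₀ (range 1 N) ⊞ S j (range 1 N)

H-suc : ∀ N j → H N (suc j) ≈ (𝟙 ⊞ q^ j) ⊠ H N j ⊞ powNegQ j (suc N)
H-suc N j = combination
  (solve 6 (λ A S′ Sj z p E → A :+ S′ :- ((con (+ 1) :+ p) :* (A :+ Sj) :+ E)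
                             := con (+ 1) :* (S′ :+ z :* A :- ((con (+ 1) :+ p) :* Sj :+ E)) :+ (:- A) :* (z :- (:- p)))
     ≈-refl (gf₀ R) (S (suc j) R) (S j R) (powNegQ j 1) (q^ j) (powNegQ j (suc N)))
  (𝟙 ⋆ S-suc j 1 N ⊹ ⊟ gf₀ R ⋆ ≈-trans (·q^-cong refl (ℕₚ.*-identityʳ j)) (·q^-neg (+ 1) j))
  where
  R = range 1 N

H-suc< : ∀ N j → H N (2 ℕ.+ j) ≈[ suc N ] (𝟙 ⊞ q^ (suc j)) ⊠ H N (suc j)
H-suc< N j = ≈[]-trans (≈⇒≈[] (H-suc N (suc j)))
  (≈[]-trans (≈[]-⊞ ≈[]-refl (≈[]-weaken (ℕₚ.m≤n*m (suc N) (suc j)) (·q^-≈[]𝟘 _ _)))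
             (≈⇒≈[] (solve 1 (λ x → x :+ con (+ 0) := x) ≈-refl _)))

H-iterate : ∀ N M → H N (suc M) ≈[ suc N ] plusPoch M ⊠ H N 1
H-iterate N zero    = ≈⇒≈[] (solve 1 (λ h → h := con (+ 1) :* h) ≈-refl (H N 1))
H-iterate N (suc M) = ≈[]-trans (H-suc< N M)
  (≈[]-trans (≈[]-⊠ ≈[]-refl (H-iterate N M))
             (≈⇒≈[] (solve 3 (λ o d h → o :* (d :* h) := d :* o :* h) ≈-refl (𝟙 ⊞ q^ (suc M)) (plusPoch M) (H N 1))))

H-top : ∀ N → H N (suc N) ≈[ suc N ] gf₀ (range 1 N)
H-top N = ≈[]-trans (≈[]-⊞ ≈[]-refl (S-≈[]𝟘 (suc N) 0 N)) (≈⇒≈[] (solve 1 (λ x → x :+ con (+ 0) := x) ≈-refl _))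

plusPoch-⊠-poch : ∀ M → plusPoch M ⊠ poch 1 1 M ≈ poch 2 2 M
plusPoch-⊠-poch zero    = ≈-trans (⊠-cong ≈-refl oneP≈𝟙) (≈-trans (solve 0 (con (+ 1) :* con (+ 1) := con (+ 1)) ≈-refl) (≈-sym oneP≈𝟙))
plusPoch-⊠-poch (suc M) = ≈-trans (⊠-cong ≈-refl (poch-suc 1 1 M)) (≈-trans (combination
  (solve 6 (λ D P P₂ u u′ w → D :* (con (+ 1) :+ u) :* (P :* (con (+ 1) :- u′)) :- P₂ :* (con (+ 1) :- w)
     := (con (+ 1) :+ u) :* (con (+ 1) :- u′) :* (D :* P :- P₂) :+ (:- (P₂ :* (con (+ 1) :+ u))) :* (u′ :- u) :+ (:- P₂) :* (u :* u :- w))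
     ≈-refl (plusPoch M) (poch 1 1 M) (poch 2 2 M) (q^ (suc M)) (q^ (1 ℕ.+ 1 ℕ.* M)) (q^ (2 ℕ.+ 2 ℕ.* M)))
  ((𝟙 ⊞ q^ (suc M)) ⊠ (𝟙 ⊞ ⊟ q^ (1 ℕ.+ 1 ℕ.* M)) ⋆ plusPoch-⊠-poch M
   ⊹ ⊟ (poch 2 2 M ⊠ (𝟙 ⊞ q^ (suc M))) ⋆ ·q^-cong refl (cong suc (ℕₚ.*-identityˡ M))
   ⊹ ⊟ poch 2 2 M ⋆ ·q^-⊠ refl (exponent M)))
  (≈-sym (poch-suc 2 2 M)))
  where
  exponent : ∀ M → suc M ℕ.+ suc M ≡ 2 ℕ.+ 2 ℕ.* M
  exponent = ℕ-solve-∀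

poch-odd-⊠-even : ∀ M → poch 1 2 M ⊠ poch 2 2 M ≈ poch 1 1 (M ℕ.+ M)
poch-odd-⊠-even zero    = ≈-trans (⊠-cong oneP≈𝟙 oneP≈𝟙) (≈-trans (solve 0 (con (+ 1) :* con (+ 1) := con (+ 1)) ≈-refl) (≈-sym oneP≈𝟙))
poch-odd-⊠-even (suc M) = ≈-trans (⊠-cong (poch-suc 1 2 M) (poch-suc 2 2 M)) (combination
  (solve 8 (λ O E P Y a b a′ b′ → O :* (con (+ 1) :- a) :* (E :* (con (+ 1) :- b)) :- Y
     := (con (+ 1) :- a) :* (con (+ 1) :- b) :* (O :* E :- P)
     :+ (:- con (+ 1)) :* (Y :- P :* (con (+ 1) :- a′) :* (con (+ 1) :- b′))
     :+ (P :* (con (+ 1) :- b′)) :* (a′ :- a)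
     :+ (P :* (con (+ 1) :- a)) :* (b′ :- b))
     ≈-refl (poch 1 2 M) (poch 2 2 M) (poch 1 1 (M ℕ.+ M)) (poch 1 1 (suc M ℕ.+ suc M))
            (q^ (1 ℕ.+ 2 ℕ.* M)) (q^ (2 ℕ.+ 2 ℕ.* M)) (q^ (1 ℕ.+ 1 ℕ.* (M ℕ.+ M))) (q^ (1 ℕ.+ 1 ℕ.* suc (M ℕ.+ M))))
  ((𝟙 ⊞ ⊟ q^ (1 ℕ.+ 2 ℕ.* M)) ⊠ (𝟙 ⊞ ⊟ q^ (2 ℕ.+ 2 ℕ.* M)) ⋆ poch-odd-⊠-even M
   ⊹ ⊟ 𝟙 ⋆ two-steps
   ⊹ poch 1 1 (M ℕ.+ M) ⊠ (𝟙 ⊞ ⊟ q^ (1 ℕ.+ 1 ℕ.* suc (M ℕ.+ M))) ⋆ ·q^-cong refl (odd M)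
   ⊹ poch 1 1 (M ℕ.+ M) ⊠ (𝟙 ⊞ ⊟ q^ (1 ℕ.+ 2 ℕ.* M)) ⋆ ·q^-cong refl (even M)))
  where
  odd : ∀ M → 1 ℕ.+ 1 ℕ.* (M ℕ.+ M) ≡ 1 ℕ.+ 2 ℕ.* M
  odd = ℕ-solve-∀
  even : ∀ M → 1 ℕ.+ 1 ℕ.* suc (M ℕ.+ M) ≡ 2 ℕ.+ 2 ℕ.* M
  even = ℕ-solve-∀
  two-steps : poch 1 1 (suc M ℕ.+ suc M)
              ≈ poch 1 1 (M ℕ.+ M) ⊠ (𝟙 ⊞ ⊟ q^ (1 ℕ.+ 1 ℕ.* (M ℕ.+ M))) ⊠ (𝟙 ⊞ ⊟ q^ (1 ℕ.+ 1 ℕ.* suc (M ℕ.+ M)))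
  two-steps rewrite ℕₚ.+-suc M M =
    ≈-trans (poch-suc 1 1 (suc (M ℕ.+ M))) (⊠-cong (poch-suc 1 1 (M ℕ.+ M)) ≈-refl)

plusPoch-⊠-poch-odd≈[]𝟙 : ∀ M → plusPoch M ⊠ poch 1 2 M ≈[ suc M ] 𝟙
plusPoch-⊠-poch-odd≈[]𝟙 M = cancelˡ-≈[] (poch 1 1 M) (poch-constant 0 1 M) (begin
  P ⊠ (plusPoch M ⊠ poch 1 2 M)         ≈⟨ ≈⇒≈[] (solve 3 (λ p d o → p :* (d :* o) := o :* (d :* p)) ≈-refl P (plusPoch M) (poch 1 2 M)) ⟩
  poch 1 2 M ⊠ (plusPoch M ⊠ P)         ≈⟨ ≈⇒≈[] (⊠-cong ≈-refl (plusPoch-⊠-poch M)) ⟩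
  poch 1 2 M ⊠ poch 2 2 M               ≈⟨ ≈⇒≈[] (poch-odd-⊠-even M) ⟩
  poch 1 1 (M ℕ.+ M)                    ≈⟨ ≈[]-weaken (ℕₚ.≤-reflexive (sym (ℕₚ.+-identityʳ (suc M)))) (poch-stable 1 1 M M) ⟩
  P                                     ≈⟨ ≈⇒≈[] (solve 1 (λ p → p := p :* con (+ 1)) ≈-refl P) ⟩
  P ⊠ 𝟙                                 ∎)
  where
  open ≈[]-Reasoning
  P = poch 1 1 M

H-one : ∀ N → H N 1 ≈[ suc N ] poch 1 2 N ⊠ gf₀ (range 1 N)
H-one N = begin
  H N 1                                  ≈⟨ ≈⇒≈[] (solve 1 (λ h → h := con (+ 1) :* h) ≈-refl (H N 1)) ⟩
  𝟙 ⊠ H N 1                              ≈⟨ ≈[]-⊠ (≈[]-sym (plusPoch-⊠-poch-odd≈[]𝟙 N)) ≈[]-refl ⟩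
  plusPoch N ⊠ poch 1 2 N ⊠ H N 1        ≈⟨ ≈⇒≈[] (solve 3 (λ d o h → d :* o :* h := o :* (d :* h)) ≈-refl (plusPoch N) (poch 1 2 N) (H N 1)) ⟩
  poch 1 2 N ⊠ (plusPoch N ⊠ H N 1)      ≈⟨ ≈[]-⊠ ≈[]-refl (≈[]-sym (H-iterate N N)) ⟩
  poch 1 2 N ⊠ H N (suc N)               ≈⟨ ≈[]-⊠ ≈[]-refl (H-top N) ⟩
  poch 1 2 N ⊠ gf₀ (range 1 N)           ∎
  where open ≈[]-Reasoning

-- (1 − q) gf₂ = q S₁ − S₂ ≡ q H₁ − H₂ + (1 − q) A ≡ (1 − q) A − (q;q²)_N A, where A = (1 − q) gf₀(2, …, N).
gf₂-range≈[] : ∀ n → gf₂ (range 1 (suc n)) ≈[ 2 ℕ.+ n ] gf₀ (range 1 (suc n)) ⊞ ⊟ (poch 1 2 (suc n) ⊠ gf₀ (range 2 n))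
gf₂-range≈[] n = cancelˡ-≈[] (oneMinusQ^ 1) refl (begin
  oneMinusQ^ 1 ⊠ gf₂ (range 1 N)                ≈⟨ ≈⇒≈[] (⊠-cong (oneMinusQ^≈ 1) ≈-refl) ⟩
  (𝟙 ⊞ ⊟ q^ 1) ⊠ gf₂ (range 1 N)                ≈⟨ combination<
      (solve 9 (λ v C A g E s₁ s₂ z₁ z₂ →
           (con (+ 1) :- v) :* C :- (con (+ 1) :- v) :* (A :- E :* g)
        := con (+ 1) :* ((con (+ 1) :- v) :* C :- (v :* s₁ :- s₂))
        :+ (:- con (+ 1)) :* (A :+ (z₂ :* g :+ s₂) :- (con (+ 1) :+ v) :* (A :+ (z₁ :* g :+ s₁)))
        :+ (:- con (+ 1)) :* (A :+ (z₁ :* g :+ s₁) :- E :* A)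
        :+ (:- E) :* (A :- (con (+ 1) :- v) :* g)
        :+ (:- (v :* g)) :* (z₁ :- (:- v))
        :+ g :* (z₂ :- (:- (v :* v))))
        ≈-refl (q^ 1) (gf₂ (range 1 N)) A g E (S 1 R) (S 2 R) (powNegQ 1 1) (powNegQ 2 1))
      ( 𝟙 ⋆< ≈⇒≈[] (one-minus-q-⊠-gf₂ 1 n)
      ⊹< ⊟ 𝟙 ⋆< H-suc< N 0
      ⊹< ⊟ 𝟙 ⋆< H-one N
      ⊹< ⊟ E ⋆< ≈⇒≈[] (gf₀-∷′ 1 R)
      ⊹< ⊟ (q^ 1 ⊠ g) ⋆< ≈⇒≈[] (·q^-neg (+ 1) 1)
      ⊹< g ⋆< ≈⇒≈[] (≈-trans (·q^-neg (+ 1) 2) (⊟-cong (≈-sym (·q^-⊠ refl refl))))) ⟩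
  (𝟙 ⊞ ⊟ q^ 1) ⊠ (A ⊞ ⊟ (E ⊠ g))                ≈⟨ ≈⇒≈[] (⊠-cong (oneMinusQ^≈ 1) ≈-refl) ⟨
  oneMinusQ^ 1 ⊠ (A ⊞ ⊟ (E ⊠ g))                ∎)
  where
  open ≈[]-Reasoning
  N = suc n
  R = range 2 n
  A = gf₀ (range 1 N)
  g = gf₀ R
  E = poch 1 2 N

rhsPS≈ : rhsPS ≈ pochInf 1 1 ⊞ ⊟ (pochInf 1 2 ⊠ pochInf 2 1)
rhsPS≈ = coeffwise λ n → sym (begin
  (pochInf 1 1 ⊞ ⊟ (pochInf 1 2 ⊠ pochInf 2 1)) n          ≡⟨ coeff-⊞ (pochInf 1 1) _ n ⟩
  pochInf 1 1 n + (⊟ (pochInf 1 2 ⊠ pochInf 2 1)) n       ≡⟨ cong (λ x → pochInf 1 1 n + x) (coeff-⊟ (pochInf 1 2 ⊠ pochInf 2 1) n) ⟩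
  pochInf 1 1 n - (pochInf 1 2 ⊠ pochInf 2 1) n           ≡⟨ cong (λ x → pochInf 1 1 n - x) (coeff-⊠ (pochInf 1 2) (pochInf 2 1) n) ⟩
  rhsPS n                                                 ∎)
  where open ≡-Reasoning

gf₂≈[]rhsPS : ∀ n → gf₂ (range 1 (suc n)) ≈[ 2 ℕ.+ n ] rhsPS
gf₂≈[]rhsPS n = begin
  gf₂ (range 1 (suc n))                                         ≈⟨ gf₂-range≈[] n ⟩
  gf₀ (range 1 (suc n)) ⊞ ⊟ (poch 1 2 (suc n) ⊠ gf₀ (range 2 n)) ≈⟨ ≈[]-⊞ (≈⇒≈[] (gf₀-range 1 (suc n)))
                                                                          (≈[]-⊟ (≈[]-⊠ ≈[]-refl (≈⇒≈[] (gf₀-range 2 n)))) ⟩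
  poch 1 1 (suc n) ⊞ ⊟ (poch 1 2 (suc n) ⊠ poch 2 1 n)          ≈⟨ ≈[]-⊞ (≈[]-weaken 2+n≤ (pochInf-≈[] 1 0 (suc n)))
                                                                          (≈[]-⊟ (≈[]-⊠ (≈[]-weaken (s≤s (s≤s (ℕₚ.m≤m+n n _))) (pochInf-≈[] 1 1 (suc n)))
                                                                                        (≈[]-weaken 2+n≤ (pochInf-≈[] 2 0 n)))) ⟨
  pochInf 1 1 ⊞ ⊟ (pochInf 1 2 ⊠ pochInf 2 1)                   ≈⟨ ≈⇒≈[] rhsPS≈ ⟨
  rhsPS                                                         ∎
  where
  open ≈[]-Reasoning
  2+n≤ : 2 ℕ.+ n ℕ.≤ 2 ℕ.+ (n ℕ.+ 0)
  2+n≤ = s≤s (s≤s (ℕₚ.m≤m+n n 0))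

-- Sums of families of power series of increasing order

Summable : (ℕ → PS) → Set
Summable W = ∀ n → W n ≈[ n ] 𝟘

-- Σₙ Wₙ; for summable W only n ≤ j contributes to the coefficient of q^j.
Σ∞ : (ℕ → PS) → PS
Σ∞ W j = Σ< (suc j) (λ n → W n j)

Summable-vanish : ∀ {W} → Summable W → ∀ {n j} → j ℕ.< n → W n j ≡ + 0
Summable-vanish {W} summable {n} {j} j<n = trans (coeff< (summable n) j j<n) (coeff-𝟘 j)

Σ∞-cong : ∀ {V W} → (∀ n → V n ≈ W n) → Σ∞ V ≈ Σ∞ W
Σ∞-cong V≈W = coeffwise (λ j → Σ<-cong′ (suc j) (λ n → coeff (V≈W n) j))

Σ∞-≈[]𝟘 : ∀ {B W} → (∀ n → W n ≈[ B ] 𝟘) → Σ∞ W ≈[ B ] 𝟘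
Σ∞-≈[]𝟘 W≈0 = coeffwise< λ j j<B →
  trans (Σ<-zero (suc j) (λ n _ → trans (coeff< (W≈0 n) j j<B) (coeff-𝟘 j))) (sym (coeff-𝟘 j))

Σ∞-suc : ∀ {W} → Summable W → Σ∞ W ≈ W 0 ⊞ Σ∞ (λ n → W (suc n))
Σ∞-suc {W} summable = coeffwise λ j → begin
  Σ< (suc j) (λ n → W n j)                                   ≡⟨ Σ<-suc-head j (λ n → W n j) ⟩
  W 0 j + Σ< j (λ n → W (suc n) j)                           ≡⟨ cong (λ x → W 0 j + x) (ℤₚ.+-identityʳ _) ⟨
  W 0 j + (Σ< j (λ n → W (suc n) j) + + 0)                   ≡⟨ cong (λ x → W 0 j + (Σ< j (λ n → W (suc n) j) + x)) (Summable-vanish summable (ℕₚ.n<1+n j)) ⟨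
  W 0 j + Σ< (suc j) (λ n → W (suc n) j)                     ≡⟨ coeff-⊞ (W 0) (Σ∞ (λ n → W (suc n))) j ⟨
  (W 0 ⊞ Σ∞ (λ n → W (suc n))) j                             ∎
  where open ≡-Reasoning

Σ∞-·q^-⊠ : ∀ {W} → Summable W → ∀ c e j → Σ< (suc j) (λ n → (mono c e ⊛ W n) j) ≡ (mono c e ⊛ Σ∞ W) j
Σ∞-·q^-⊠ {W} summable c e j with <-or-+ e j
... | inj₁ j<e = trans (Σ<-zero (suc j) (λ n _ → mono-⊛-< c (W n) j<e)) (sym (mono-⊛-< c (Σ∞ W) j<e))
... | inj₂ (i , refl) = begin
  Σ< (suc (e ℕ.+ i)) (λ n → (mono c e ⊛ W n) (e ℕ.+ i))   ≡⟨ Σ<-cong′ (suc (e ℕ.+ i)) (λ n → mono-⊛-+ c e (W n) i) ⟩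
  Σ< (suc (e ℕ.+ i)) (λ n → c * W n i)                    ≡⟨ Σ<-*ˡ (suc (e ℕ.+ i)) c (λ n → W n i) ⟩
  c * Σ< (suc (e ℕ.+ i)) (λ n → W n i)                    ≡⟨ cong (λ m → c * Σ< (suc m) (λ n → W n i)) (ℕₚ.+-comm e i) ⟩
  c * Σ< (suc i ℕ.+ e) (λ n → W n i)                      ≡⟨ cong (c *_) (Σ<-extend (suc i) e (λ n → W n i) (λ n i<n → Summable-vanish summable i<n)) ⟩
  c * Σ∞ W i                                              ≡⟨ mono-⊛-+ c e (Σ∞ W) i ⟨
  (mono c e ⊛ Σ∞ W) (e ℕ.+ i)                             ∎
  where open ≡-Reasoning

Σ∞-⊞-·q^-⊠ : ∀ {W} → Summable W → ∀ V c e → Σ∞ (λ n → V n ⊞ c ·q^ e ⊠ W n) ≈ Σ∞ V ⊞ c ·q^ e ⊠ Σ∞ W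
Σ∞-⊞-·q^-⊠ {W} summable V c e = coeffwise λ j → begin
  Σ< (suc j) (λ n → (V n ⊞ c ·q^ e ⊠ W n) j)              ≡⟨ Σ<-cong′ (suc j) (λ n → trans (coeff-⊞ (V n) _ j) (cong (λ x → V n j + x) (coeff (≈-sym (mono-⊛≈ c e (W n))) j))) ⟩
  Σ< (suc j) (λ n → V n j + (mono c e ⊛ W n) j)           ≡⟨ Σ<-+ (suc j) (λ n → V n j) _ ⟩
  Σ∞ V j + Σ< (suc j) (λ n → (mono c e ⊛ W n) j)          ≡⟨ cong (λ x → Σ∞ V j + x) (Σ∞-·q^-⊠ summable c e j) ⟩
  Σ∞ V j + (mono c e ⊛ Σ∞ W) j                            ≡⟨ cong (λ x → Σ∞ V j + x) (coeff (mono-⊛≈ c e (Σ∞ W)) j) ⟩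
  Σ∞ V j + (c ·q^ e ⊠ Σ∞ W) j                             ≡⟨ coeff-⊞ (Σ∞ V) _ j ⟨
  (Σ∞ V ⊞ c ·q^ e ⊠ Σ∞ W) j                               ∎
  where open ≡-Reasoning

-- The sum side

binom₂ : ℕ → ℕ
binom₂ zero    = 0
binom₂ (suc n) = binom₂ n ℕ.+ n

binom₂-suc-*2 : ∀ n → binom₂ (suc n) ℕ.* 2 ≡ n ℕ.* suc n
binom₂-suc-*2 zero    = refl
binom₂-suc-*2 (suc n) = begin
  (binom₂ (suc n) ℕ.+ suc n) ℕ.* 2         ≡⟨ ℕₚ.*-distribʳ-+ 2 (binom₂ (suc n)) (suc n) ⟩
  binom₂ (suc n) ℕ.* 2 ℕ.+ suc n ℕ.* 2     ≡⟨ cong (ℕ._+ suc n ℕ.* 2) (binom₂-suc-*2 n) ⟩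
  n ℕ.* suc n ℕ.+ suc n ℕ.* 2              ≡⟨ step n ⟩
  suc n ℕ.* suc (suc n)                    ∎
  where
  open ≡-Reasoning
  step : ∀ n → n ℕ.* suc n ℕ.+ suc n ℕ.* 2 ≡ suc n ℕ.* suc (suc n)
  step = ℕ-solve-∀

binom₂-suc : ∀ n → binom₂ (suc n) ≡ (n ℕ.* suc n) ℕ./ 2
binom₂-suc n = sym (trans (cong (ℕ._/ 2) (sym (binom₂-suc-*2 n))) (m*n/n≡m (binom₂ (suc n)) 2))

invPoch : ℕ → PS
invPoch n = invPS (poch 1 1 n)

invOnePlusQ^ : ℕ → PS
invOnePlusQ^ e = invPS (onePlusQ^ e)

invPoch-zero : invPoch 0 ≈ 𝟙
invPoch-zero = begin
  invPoch 0                  ≈⟨ solve 1 (λ i → i := con (+ 1) :* i) ≈-refl (invPoch 0) ⟩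
  𝟙 ⊠ invPoch 0              ≈⟨ ⊠-cong (≈-sym oneP≈𝟙) ≈-refl ⟩
  oneP ⊠ invPoch 0           ≈⟨ invPS-inverse oneP refl ⟩
  𝟙                          ∎
  where open ≈-Reasoning

invPoch-suc : ∀ n → invPoch n ≈ (𝟙 ⊞ ⊟ q^ (suc n)) ⊠ invPoch (suc n)
invPoch-suc n = begin
  invPoch n                                              ≈⟨ solve 1 (λ i → i := i :* con (+ 1)) ≈-refl (invPoch n) ⟩
  invPoch n ⊠ 𝟙                                          ≈⟨ ⊠-cong ≈-refl (invPS-inverse (poch 1 1 (suc n)) (poch-constant 0 1 (suc n))) ⟨
  invPoch n ⊠ (poch 1 1 (suc n) ⊠ invPoch (suc n))        ≈⟨ ⊠-cong ≈-refl (⊠-cong (poch-suc 1 1 n) ≈-refl) ⟩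
  invPoch n ⊠ (poch 1 1 n ⊠ u ⊠ invPoch (suc n))          ≈⟨ solve 4 (λ i p u j → i :* (p :* u :* j) := (p :* i) :* (u :* j)) ≈-refl (invPoch n) (poch 1 1 n) u (invPoch (suc n)) ⟩
  (poch 1 1 n ⊠ invPoch n) ⊠ (u ⊠ invPoch (suc n))        ≈⟨ ⊠-cong (invPS-inverse (poch 1 1 n) (poch-constant 0 1 n)) ≈-refl ⟩
  𝟙 ⊠ (u ⊠ invPoch (suc n))                              ≈⟨ solve 1 (λ x → con (+ 1) :* x := x) ≈-refl (u ⊠ invPoch (suc n)) ⟩
  u ⊠ invPoch (suc n)                                    ≈⟨ ⊠-cong (⊞-cong ≈-refl (⊟-cong (·q^-cong refl (cong suc (ℕₚ.*-identityˡ n))))) ≈-refl ⟩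
  (𝟙 ⊞ ⊟ q^ (suc n)) ⊠ invPoch (suc n)                   ∎
  where
  open ≈-Reasoning
  u = 𝟙 ⊞ ⊟ q^ (1 ℕ.+ 1 ℕ.* n)

over-one-plus-q^ : ∀ m m′ c F G d → m ⊠ q^ (suc d) ≈ ⊟ m′ → c ⊠ G ≈ m ⊠ F →
                   m ⊠ F ⊠ invOnePlusQ^ (suc d) ≈ m′ ⊠ F ⊠ invOnePlusQ^ (suc d) ⊞ c ⊠ G
over-one-plus-q^ m m′ c F G d mu≈-m′ cG≈mF = combination
  (solve 7 (λ m m′ c F G u J → m :* F :* J :- (m′ :* F :* J :+ c :* G)
     := (m :* F) :* ((con (+ 1) :+ u) :* J :- con (+ 1)) :+ (:- (F :* J)) :* (m :* u :- (:- m′)) :+ (:- con (+ 1)) :* (c :* G :- m :* F))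
     ≈-refl m m′ c F G (q^ (suc d)) J)
  (m ⊠ F ⋆ ≈-trans (⊠-cong (≈-sym (onePlusQ^≈ (suc d))) ≈-refl) (invPS-inverse (onePlusQ^ (suc d)) refl)
   ⊹ ⊟ (F ⊠ J) ⋆ mu≈-m′
   ⊹ ⊟ 𝟙 ⋆ cG≈mF)
  where
  J = invOnePlusQ^ (suc d)

termA termB termC : ℕ → ℕ → PS
termA n k = sgn n ·q^ (binom₂ n ℕ.+ k ℕ.* n) ⊠ invPoch n
termB n k = sgn (suc k ℕ.+ n) ·q^ (binom₂ (suc n) ℕ.+ k ℕ.* suc n) ⊠ invPoch n ⊠ invOnePlusQ^ (suc n)
termC n k = sgn (suc k ℕ.+ n) ·q^ (binom₂ (2 ℕ.+ n) ℕ.+ k ℕ.* (2 ℕ.+ n))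
            ⊠ invPoch n ⊠ invOnePlusQ^ (suc n) ⊠ invOnePlusQ^ (2 ℕ.+ n)

termA-zero : ∀ k → termA 0 k ≈ 𝟙
termA-zero k = begin
  sgn 0 ·q^ (k ℕ.* 0) ⊠ invPoch 0   ≈⟨ ⊠-cong (·q^-cong refl (ℕₚ.*-zeroʳ k)) invPoch-zero ⟩
  𝟙 ⊠ 𝟙                              ≈⟨ solve 0 (con (+ 1) :* con (+ 1) := con (+ 1)) ≈-refl ⟩
  𝟙                                  ∎
  where open ≈-Reasoning

termA-suc : ∀ n k → termA (suc n) k ≈ termA (suc n) (suc k) ⊞ (- + 1) ·q^ k ⊠ termA n (suc k)
termA-suc n k = combination
  (solve 7 (λ m m′ c m₀ u I₀ I₁ → m :* I₁ :- (m′ :* I₁ :+ c :* (m₀ :* I₀))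
     := I₁ :* (m :* u :- m′) :+ (:- (c :* m₀)) :* (I₀ :- (con (+ 1) :- u) :* I₁) :+ (:- ((con (+ 1) :- u) :* I₁)) :* (c :* m₀ :- m))
     ≈-refl m m′ c m₀ (q^ (suc n)) (invPoch n) (invPoch (suc n)))
  (invPoch (suc n) ⋆ ·q^-⊠ (ℤₚ.*-identityʳ σ) (exponent₁ (binom₂ n) n k)
   ⊹ ⊟ (c ⊠ m₀) ⋆ invPoch-suc n
   ⊹ ⊟ ((𝟙 ⊞ ⊟ q^ (suc n)) ⊠ invPoch (suc n)) ⋆ ·q^-⊠ (trans (ℤₚ.-1*i≡-i (sgn n)) (sym (sgn-suc n))) (exponent₂ (binom₂ n) n k))
  where
  σ = sgn (suc n)
  m = σ ·q^ (binom₂ (suc n) ℕ.+ k ℕ.* suc n)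
  m′ = σ ·q^ (binom₂ (suc n) ℕ.+ suc k ℕ.* suc n)
  m₀ = sgn n ·q^ (binom₂ n ℕ.+ suc k ℕ.* n)
  c = (- + 1) ·q^ k
  exponent₁ : ∀ b n k → b ℕ.+ n ℕ.+ k ℕ.* suc n ℕ.+ suc n ≡ b ℕ.+ n ℕ.+ suc k ℕ.* suc n
  exponent₁ = ℕ-solve-∀
  exponent₂ : ∀ b n k → k ℕ.+ (b ℕ.+ suc k ℕ.* n) ≡ b ℕ.+ n ℕ.+ k ℕ.* suc n
  exponent₂ = ℕ-solve-∀

termB-suc : ∀ n k → termB n k ≈ termB n (suc k) ⊞ (- sgn k) ·q^ k ⊠ termA n (suc k)
termB-suc n k = over-one-plus-q^ _ _ _ (invPoch n) _ n
  (·q^-⊠-q^-flip (suc n) (sgn-suc (suc k ℕ.+ n)) (exponent (binom₂ (suc n)) n k))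
  (≈-trans (≈-sym (⊠-assoc _ _ (invPoch n))) (⊠-cong (·q^-⊠ sign (exponent′ (binom₂ n) n k)) ≈-refl))
  where
  σ = sgn (suc k ℕ.+ n)
  exponent : ∀ b n k → b ℕ.+ k ℕ.* suc n ℕ.+ suc n ≡ b ℕ.+ suc k ℕ.* suc n
  exponent = ℕ-solve-∀
  exponent′ : ∀ b n k → k ℕ.+ (b ℕ.+ suc k ℕ.* n) ≡ b ℕ.+ n ℕ.+ k ℕ.* suc n
  exponent′ = ℕ-solve-∀
  sign : - sgn k * sgn n ≡ σ
  sign = trans (cong (_* sgn n) (sym (sgn-suc k))) (sym (sgn-+ (suc k) n))

termC-suc : ∀ n k → termC n k ≈ termC n (suc k) ⊞ (- + 1) ·q^ k ⊠ termB n (suc k)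
termC-suc n k = begin
  m ⊠ I ⊠ J₁ ⊠ J₂                          ≈⟨ ⊠-cong (⊠-assoc m I J₁) ≈-refl ⟩
  m ⊠ (I ⊠ J₁) ⊠ J₂                        ≈⟨ over-one-plus-q^ m m′ c (I ⊠ J₁) (r ⊠ I ⊠ J₁) (suc n)
                                                 (·q^-⊠-q^-flip (2 ℕ.+ n) (sgn-suc (suc k ℕ.+ n)) (exponent (binom₂ (2 ℕ.+ n)) n k))
                                                 (≈-trans (solve 4 (λ c r I J → c :* (r :* I :* J) := c :* r :* (I :* J)) ≈-refl c r I J₁)
                                                          (⊠-cong (·q^-⊠ sign (exponent′ (binom₂ (suc n)) n k)) ≈-refl)) ⟩
  m′ ⊠ (I ⊠ J₁) ⊠ J₂ ⊞ c ⊠ termB n (suc k) ≈⟨ ⊞-cong (⊠-cong (⊠-assoc m′ I J₁) ≈-refl) ≈-refl ⟨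
  termC n (suc k) ⊞ c ⊠ termB n (suc k)    ∎
  where
  open ≈-Reasoning
  σ = sgn (suc k ℕ.+ n)
  m = σ ·q^ (binom₂ (2 ℕ.+ n) ℕ.+ k ℕ.* (2 ℕ.+ n))
  m′ = sgn (2 ℕ.+ k ℕ.+ n) ·q^ (binom₂ (2 ℕ.+ n) ℕ.+ suc k ℕ.* (2 ℕ.+ n))
  r = sgn (2 ℕ.+ k ℕ.+ n) ·q^ (binom₂ (suc n) ℕ.+ suc k ℕ.* suc n)
  c = (- + 1) ·q^ k
  I = invPoch n
  J₁ = invOnePlusQ^ (suc n)
  J₂ = invOnePlusQ^ (2 ℕ.+ n)
  exponent : ∀ b n k → b ℕ.+ k ℕ.* (2 ℕ.+ n) ℕ.+ (2 ℕ.+ n) ≡ b ℕ.+ suc k ℕ.* (2 ℕ.+ n)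
  exponent = ℕ-solve-∀
  exponent′ : ∀ b n k → k ℕ.+ (b ℕ.+ suc k ℕ.* suc n) ≡ b ℕ.+ suc n ℕ.+ k ℕ.* (2 ℕ.+ n)
  exponent′ = ℕ-solve-∀
  sign : - + 1 * sgn (2 ℕ.+ k ℕ.+ n) ≡ σ
  sign = trans (ℤₚ.-1*i≡-i _) (trans (cong -_ (sgn-suc (suc k ℕ.+ n))) (ℤₚ.neg-involutive σ))

termA-≈[]𝟘 : ∀ n k → termA n k ≈[ binom₂ n ℕ.+ k ℕ.* n ] 𝟘
termA-≈[]𝟘 n k = ·q^-⊠-≈[]𝟘 _ _ _

termB-≈[]𝟘 : ∀ n k → termB n k ≈[ binom₂ (suc n) ℕ.+ k ℕ.* suc n ] 𝟘
termB-≈[]𝟘 n k = ⊠-≈[]𝟘 _ (·q^-⊠-≈[]𝟘 _ _ _)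

termC-≈[]𝟘 : ∀ n k → termC n k ≈[ binom₂ (2 ℕ.+ n) ℕ.+ k ℕ.* (2 ℕ.+ n) ] 𝟘
termC-≈[]𝟘 n k = ⊠-≈[]𝟘 _ (⊠-≈[]𝟘 _ (·q^-⊠-≈[]𝟘 _ _ _))

summableA : ∀ k → Summable (λ n → termA n (suc k))
summableA k n = ≈[]-weaken (ℕₚ.≤-trans (ℕₚ.m≤m+n n (k ℕ.* n)) (ℕₚ.m≤n+m _ (binom₂ n))) (termA-≈[]𝟘 n (suc k))

summableB : ∀ k → Summable (λ n → termB n k)
summableB k n = ≈[]-weaken (ℕₚ.≤-trans (ℕₚ.m≤n+m n (binom₂ n)) (ℕₚ.m≤m+n _ _)) (termB-≈[]𝟘 n k)

ΣA ΣB ΣC : ℕ → PS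
ΣA k = Σ∞ (λ n → termA n k)
ΣB k = Σ∞ (λ n → termB n k)
ΣC k = Σ∞ (λ n → termC n k)

ΣA-suc : ∀ k → ΣA (suc k) ≈ ΣA (2 ℕ.+ k) ⊞ (- + 1) ·q^ (suc k) ⊠ ΣA (2 ℕ.+ k)
ΣA-suc k = begin
  ΣA (suc k)                                              ≈⟨ Σ∞-suc (summableA k) ⟩
  termA 0 (suc k) ⊞ Σ∞ (λ n → termA (suc n) (suc k))      ≈⟨ ⊞-cong ≈-refl (Σ∞-cong (λ n → termA-suc n (suc k))) ⟩
  termA 0 (suc k) ⊞ Σ∞ (λ n → termA (suc n) (2 ℕ.+ k) ⊞ c ⊠ termA n (2 ℕ.+ k))
                                                          ≈⟨ ⊞-cong ≈-refl (Σ∞-⊞-·q^-⊠ (summableA (suc k)) _ _ _) ⟩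
  termA 0 (2 ℕ.+ k) ⊞ (Σ∞ (λ n → termA (suc n) (2 ℕ.+ k)) ⊞ c ⊠ ΣA (2 ℕ.+ k))
                                                          ≈⟨ solve 3 (λ x y z → x :+ (y :+ z) := x :+ y :+ z) ≈-refl _ _ _ ⟩
  termA 0 (2 ℕ.+ k) ⊞ Σ∞ (λ n → termA (suc n) (2 ℕ.+ k)) ⊞ c ⊠ ΣA (2 ℕ.+ k)
                                                          ≈⟨ ⊞-cong (Σ∞-suc (summableA (suc k))) ≈-refl ⟨
  ΣA (2 ℕ.+ k) ⊞ c ⊠ ΣA (2 ℕ.+ k)                         ∎
  where
  open ≈-Reasoning
  c = (- + 1) ·q^ (suc k)

ΣB-suc : ∀ k → ΣB k ≈ ΣB (suc k) ⊞ (- sgn k) ·q^ k ⊠ ΣA (suc k)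
ΣB-suc k = ≈-trans (Σ∞-cong (λ n → termB-suc n k)) (Σ∞-⊞-·q^-⊠ (summableA k) _ _ _)

ΣC-suc : ∀ k → ΣC k ≈ ΣC (suc k) ⊞ (- + 1) ·q^ k ⊠ ΣB (suc k)
ΣC-suc k = ≈-trans (Σ∞-cong (λ n → termC-suc n k)) (Σ∞-⊞-·q^-⊠ (summableB (suc k)) _ _ _)

ΣA-≈[]𝟙 : ∀ k → ΣA (suc k) ≈[ suc k ] 𝟙
ΣA-≈[]𝟙 k = begin
  ΣA (suc k)                                            ≈⟨ ≈⇒≈[] (Σ∞-suc (summableA k)) ⟩
  termA 0 (suc k) ⊞ Σ∞ (λ n → termA (suc n) (suc k))    ≈⟨ ≈[]-⊞ (≈⇒≈[] (termA-zero (suc k))) (Σ∞-≈[]𝟘 higher) ⟩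
  𝟙 ⊞ 𝟘                                                 ≈⟨ ≈⇒≈[] (solve 0 (con (+ 1) :+ con (+ 0) := con (+ 1)) ≈-refl) ⟩
  𝟙                                                     ∎
  where
  open ≈[]-Reasoning
  higher : ∀ n → termA (suc n) (suc k) ≈[ suc k ] 𝟘
  higher n = ≈[]-weaken (ℕₚ.≤-trans (ℕₚ.m≤m*n (suc k) (suc n)) (ℕₚ.m≤n+m _ _)) (termA-≈[]𝟘 (suc n) (suc k))

ΣB-≈[]𝟘 : ∀ k → ΣB k ≈[ k ] 𝟘
ΣB-≈[]𝟘 k = Σ∞-≈[]𝟘 λ n → ≈[]-weaken (ℕₚ.≤-trans (ℕₚ.m≤m*n k (suc n)) (ℕₚ.m≤n+m _ _)) (termB-≈[]𝟘 n k)

ΣC-≈[]𝟘 : ∀ k → ΣC k ≈[ k ] 𝟘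
ΣC-≈[]𝟘 k = Σ∞-≈[]𝟘 λ n → ≈[]-weaken (ℕₚ.≤-trans (ℕₚ.m≤m*n k (2 ℕ.+ n)) (ℕₚ.m≤n+m _ _)) (termC-≈[]𝟘 n k)

same-recurrence-≈[] : ∀ {B F F′ G′ H H′ K′} c → F ≈ F′ ⊞ c ⊠ G′ → H ≈ H′ ⊞ c ⊠ K′ →
                      F′ ≈[ B ] H′ → G′ ≈[ B ] K′ → F ≈[ B ] H
same-recurrence-≈[] c F≈ H≈ F′≈H′ G′≈K′ =
  ≈[]-trans (≈⇒≈[] F≈) (≈[]-trans (≈[]-⊞ F′≈H′ (≈[]-⊠ ≈[]-refl G′≈K′)) (≈⇒≈[] (≈-sym H≈)))

gf-range≈[]Σ : ∀ l k → gf₀ (range (suc k) l) ≈[ suc k ℕ.+ l ] ΣA (suc k)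
                     × gf₁ (range (suc k) l) ≈[ suc k ℕ.+ l ] ΣB (suc k)
                     × gf₂ (range (suc k) l) ≈[ suc k ℕ.+ l ] ΣC (suc k)
gf-range≈[]Σ zero k rewrite ℕₚ.+-identityʳ k =
    ≈[]-trans (≈⇒≈[] gf₀-[]) (≈[]-sym (ΣA-≈[]𝟙 k))
  , ≈[]-trans (≈⇒≈[] gf₁-[]) (≈[]-sym (ΣB-≈[]𝟘 (suc k)))
  , ≈[]-trans (≈⇒≈[] gf₂-[]) (≈[]-sym (ΣC-≈[]𝟘 (suc k)))
gf-range≈[]Σ (suc l) k rewrite ℕₚ.+-suc k l with gf-range≈[]Σ l (suc k)
... | A≈ , B≈ , C≈ =
    same-recurrence-≈[] _ (gf₀-∷ (suc k) R) (ΣA-suc k) A≈ A≈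
  , same-recurrence-≈[] _ (gf₁-∷ (suc k) R) (ΣB-suc (suc k)) B≈ A≈
  , same-recurrence-≈[] _ (gf₂-∷ (suc k) R) (ΣC-suc (suc k)) C≈ B≈
  where
  R = range (2 ℕ.+ k) l

termC-one≈term : ∀ n → termC n 1 ≈ term (2 ℕ.+ n)
termC-one≈term n = ≈-sym (begin
  term (2 ℕ.+ n)                                       ≈⟨ ≈-trans (⊛≈⊠ _ J₂) (⊠-cong (≈-trans (⊛≈⊠ _ J₁) (⊠-cong (mono-⊛≈ _ _ I) ≈-refl)) ≈-refl) ⟩
  sgn (2 ℕ.+ n) ·q^ E ⊠ I ⊠ J₁ ⊠ J₂                   ≈⟨ ⊠-cong (⊠-cong (⊠-cong (·q^-cong refl exponent) ≈-refl) ≈-refl) ≈-refl ⟨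
  termC n 1                                            ∎)
  where
  open ≈-Reasoning
  E = ((2 ℕ.+ n) ℕ.* (3 ℕ.+ n)) ℕ./ 2
  I = invPoch n
  J₁ = invOnePlusQ^ (suc n)
  J₂ = invOnePlusQ^ (2 ℕ.+ n)
  exponent : binom₂ (2 ℕ.+ n) ℕ.+ 1 ℕ.* (2 ℕ.+ n) ≡ E
  exponent = trans (cong (binom₂ (2 ℕ.+ n) ℕ.+_) (ℕₚ.*-identityˡ (2 ℕ.+ n))) (binom₂-suc (2 ℕ.+ n))

ΣC-one≡midPS : ∀ m → ΣC 1 m ≡ midPS m
ΣC-one≡midPS m = begin
  Σ< m (λ n → termC n 1 m) + termC m 1 m      ≡⟨ cong₂ _+_ (Σ<-cong′ m (λ n → coeff (termC-one≈term n) m)) top-vanishes ⟩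
  midPS m + + 0                               ≡⟨ ℤₚ.+-identityʳ (midPS m) ⟩
  midPS m                                     ∎
  where
  open ≡-Reasoning
  top-vanishes : termC m 1 m ≡ + 0
  top-vanishes = trans (coeff< (termC-≈[]𝟘 m 1) m m<exponent) (coeff-𝟘 m)
    where
    m<exponent : m ℕ.< binom₂ (2 ℕ.+ m) ℕ.+ 1 ℕ.* (2 ℕ.+ m)
    m<exponent = ℕₚ.≤-trans (ℕₚ.n≤1+n (suc m))
                   (ℕₚ.≤-trans (ℕₚ.≤-reflexive (sym (ℕₚ.*-identityˡ (2 ℕ.+ m)))) (ℕₚ.m≤n+m _ (binom₂ (2 ℕ.+ m))))

lhs≡mid : ∀ m → lhsPS m ≡ midPS m
lhs≡mid zero    = refl
lhs≡mid (suc m) = begin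
  a (suc m)                          ≡⟨ a≡gf₂ (suc m) ⟩
  gf₂ (oneTo (suc m)) (suc m)        ≡⟨ cong (λ xs → gf₂ xs (suc m)) (oneTo≡range (suc m)) ⟩
  gf₂ (range 1 (suc m)) (suc m)      ≡⟨ coeff< (proj₂ (proj₂ (gf-range≈[]Σ (suc m) 0))) (suc m) (ℕₚ.n<1+n (suc m)) ⟩
  ΣC 1 (suc m)                       ≡⟨ ΣC-one≡midPS (suc m) ⟩
  midPS (suc m)                      ∎
  where open ≡-Reasoning

lhs≡rhs : ∀ m → lhsPS m ≡ rhsPS m
lhs≡rhs zero    = refl
lhs≡rhs (suc n) = begin
  a (suc n)                          ≡⟨ a≡gf₂ (suc n) ⟩
  gf₂ (oneTo (suc n)) (suc n)        ≡⟨ cong (λ xs → gf₂ xs (suc n)) (oneTo≡range (suc n)) ⟩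
  gf₂ (range 1 (suc n)) (suc n)      ≡⟨ coeff< (gf₂≈[]rhsPS n) (suc n) (ℕₚ.n<1+n (suc n)) ⟩
  rhsPS (suc n)                      ∎
  where open ≡-Reasoning

corollary3p6 : (m : ℕ) → (lhsPS m ≡ midPS m) × (midPS m ≡ rhsPS m)
corollary3p6 m = lhs≡mid m , trans (sym (lhs≡mid m)) (lhs≡rhs m)
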